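{- Let $r\ge k$ and let $\mathcal{I}$ be an instance of $\mathrm{CSP}(P)$ with $P:\{0,1\}^k\to\{0,1\}$. Then: (1) the restriction to sets of size at most $r$ of any family in $\mathrm{SA}^{r+k+1}(L_{\mathcal{I}})$ lies in $\mathrm{SA}^r(R_{\mathcal{I}})$, and the restriction of any family in $\mathrm{SA}^{r+k+1}(R_{\mathcal{I}})$ lies in $\mathrm{SA}^r(L_{\mathcal{I}})$; (2) the same two statements hold with $\mathrm{SA}$ replaced by $\mathrm{SA}_+$; (3) the same two statements hold with $\mathrm{SA}$ replaced by $\mathrm{StaticLS}_+$.
   Context: An instance of $\mathrm{CSP}(P)$ on $x_1,\dots,x_n\in\{0,1\}$ is a multiset of constraints $(c,S)$, $c\in\{0,1\}^k$, $S\in[n]^k$, meaning $P(x_S\oplus c)=1$. For $a\in\mathbb{R}$, $b\in\{0,1\}$, $a^{(b)}=a$ if $b=0$, $1-a$ if $b=1$ (coordinatewise for vectors). $P'$ is the unique multilinear polynomial equal to $P$ on $\{0,1\}^k$. $R_{\mathcal{I}}=\{P'(x^{(c)}_S)-1=0:(c,S)\in\mathcal{I}\}$; with $F=P^{ -1}(0)$, $L_{\mathcal{I}}=\{\sum_{i=1}^kx_{S_i}^{(c_i\oplus f_i)}-1\ge0:(c,S)\in\mathcal{I},f\in F\}$. $\mathbf{1}_{\{x_T=\alpha\}}(x)=\prod_{i\in T}x_i^{(1-\alpha_i)}$; degree means multilinear degree. A family $\{D_S\}_{S\subseteq[n],|S|\le r}$ of distributions on $\{0,1\}^S$ is $r$-locally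 consistent if for $T\subseteq S$, $|S|\le r$, the marginal of $D_S$ on $T$ is $D_T$; for a multilinear polynomial $p$ in at most $r$ variables $V$, $\mathbb{E}_D[p]=\mathbb{E}_{y\sim D_V}[p(y)]$ (extended by linearity; $x_i^2$ is replaced by $x_i$). For a set $A$ of constraints $g\ge0$ or $g=0$, $\mathrm{SA}^r(A)$ is the set of $r$-locally consistent families with $\mathbb{E}_D[\mathbf{1}_{\{x_T=\alpha\}}(x)g(x)]\ge0$ (resp. $=0$) for all constraints, $T\subseteq[n]$, $\alpha\in\{0,1\}^T$ with $\deg(\mathbf{1}_{\{x_T=\alpha\}}g)\le r$. $\mathrm{SA}_+^r(A)$: families in $\mathrm{SA}^r(A)$ whose matrix $M$ indexed by $\{0\}\cup([n]\times\{0,1\})$, $M(0,0)=1$, $M(0,(i,a))=D_{\{i\}}(x_i=a)$, $M((i,a),(j,b))=D_{\{i,j\}}(x_i=a\wedge x_j=b)$, is positive semidefinite. $\mathrm{StaticLS}_+^r(A)$: families in $\mathrm{SA}^r(A)$ such that for all $X\subseteq[n]$, $|X|\le r-2$, $\alpha\in\{0,1\}^X$, the matrix $M_{X,\alpha}$ with $M_{X,\alpha}(0,0)=D_X(X=\alpha)$, $M_{X,\alpha}(0,(i,a))=D_{\{i\}\cup X}(x_i=a\wedge X=\alpha)$, $M_{X,\alpha}((i,a),(j,b))=D_{\{i,j\}\cup X}(x_i=a\wedge x_j=b\wedge X=\alpha)$ is positive semidefinite. -}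

module Defs where

open import Level using (Level; _⊔_) renaming (suc to lsuc)
open import Data.Nat using (ℕ; zero; suc) renaming (_+_ to _+ℕ_; _≤_ to _≤ℕ_; _<_ to _<ℕ_)
open import Data.Bool using (Bool; true; false; not; _∧_; _xor_; if_then_else_)
open import Data.Fin using (Fin)
open import Data.Vec using (Vec; []; _∷_; lookup)
open import Data.Vec.Properties using (≡-dec)
open import Data.List using (List; []; _∷_; map; _++_; foldr; concatMap; filter; allFin)
open import Data.List.Membership.Propositional using (_∈_)
open import Data.Maybe using (Maybe; nothing; just)
open import Data.Product using (_×_; _,_; ∃)
open import Data.Fin.Subset using (Subset; ⁅_⁆; ⊥; _∪_; _∩_; _⊆_; ∣_∣)
open import Data.Fin.Subset.Properties using (_⊆?_)
open import Relation.Nullary using (¬_; does)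
open import Relation.Binary using (Rel; IsTotalOrder)
open import Algebra.Bundles using (CommutativeRing)
import Data.Bool as B

-- Ordered fields (the stdlib has no reals; we work over an arbitrary
-- ordered field, of which ℝ is an instance).

record OrderedField (c ℓ₁ ℓ₂ : Level) : Set (lsuc (c ⊔ ℓ₁ ⊔ ℓ₂)) where
  field
    commutativeRing : CommutativeRing c ℓ₁
  open CommutativeRing commutativeRing public
  infix 4 _≤F_
  field
    _≤F_         : Rel Carrier ℓ₂
    isTotalOrder : IsTotalOrder _≈_ _≤F_
    +-mono-≤     : ∀ {a b} c → a ≤F b → (a + c) ≤F (b + c)
    *-nonneg     : ∀ {a b} → 0# ≤F a → 0# ≤F b → 0# ≤F (a * b)
    0≉1          : ¬ (0# ≈ 1#)
    inverse      : ∀ a → ¬ (a ≈ 0#) → ∃ λ b → (a * b) ≈ 1#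

-- all elements of {0,1}^n (a vector of booleans = a subset of Fin n)
allVecs : (n : ℕ) → List (Vec Bool n)
allVecs zero    = [] ∷ []
allVecs (suc n) = map (false ∷_) (allVecs n) ++ map (true ∷_) (allVecs n)

eqB : ∀ {n} → Vec Bool n → Vec Bool n → Bool
eqB u v = does (≡-dec B._≟_ u v)

subB : ∀ {n} → Subset n → Subset n → Bool
subB u v = does (u ⊆? v)

agreeOn : ∀ {n} → Subset n → Subset n → Subset n → Bool
agreeOn X y α = eqB (y ∩ X) (α ∩ X)

Constraint : ℕ → ℕ → Set
Constraint n k = Vec Bool k × Vec (Fin n) k

Instance : ℕ → ℕ → Set
Instance n k = List (Constraint n k)

module _ {c ℓ₁ ℓ₂ : Level} (F : OrderedField c ℓ₁ ℓ₂) where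
  open OrderedField F

  Σl : ∀ {a} {A : Set a} → List A → (A → Carrier) → Carrier
  Σl xs f = foldr (λ x acc → f x + acc) 0# xs

  -- Multilinear polynomials in n variables x_0 … x_{n-1}:
  -- p m is the coefficient of the monomial ∏_{i ∈ m} x_i.

  Poly : ℕ → Set c
  Poly n = Subset n → Carrier

  constP : ∀ {n} → Carrier → Poly n
  constP {n} a m = if eqB m (⊥) then a else 0#

  varP : ∀ {n} → Fin n → Poly n
  varP i m = if eqB m ⁅ i ⁆ then 1# else 0#

  _+P_ : ∀ {n} → Poly n → Poly n → Poly n
  (p +P q) m = p m + q m

  _-P_ : ∀ {n} → Poly n → Poly n → Poly n
  (p -P q) m = p m - q m

  scaleP : ∀ {n} → Carrier → Poly n → Poly n
  scaleP a p m = a * p m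

  -- product, multilinearised (x_i² replaced by x_i)
  _*P_ : ∀ {n} → Poly n → Poly n → Poly n
  _*P_ {n} p q m =
    Σl (allVecs n) λ a → Σl (allVecs n) λ b →
      if eqB (a ∪ b) m then p a * q b else 0#

  ΣP : ∀ {a} {A : Set a} {n} → List A → (A → Poly n) → Poly n
  ΣP xs f = foldr (λ x acc → f x +P acc) (constP 0#) xs

  ΠP : ∀ {a} {A : Set a} {n} → List A → (A → Poly n) → Poly n
  ΠP xs f = foldr (λ x acc → f x *P acc) (constP 1#) xs

  DegLe : ∀ {n} → Poly n → ℕ → Set (ℓ₁)
  DegLe p r = ∀ m → r <ℕ ∣ m ∣ → p m ≈ 0#

  evalP : ∀ {n} → Poly n → Vec Bool n → Carrier
  evalP {n} p β = Σl (allVecs n) λ m → if subB m β then p m else 0#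

  substP : ∀ {k n} → Poly k → (Fin k → Poly n) → Poly n
  substP {k} P' q =
    ΣP (allVecs k) λ m → scaleP (P' m) (ΠP (allFin k) λ j →
      if lookup m j then q j else constP 1#)

  litP : ∀ {n} → Fin n → Bool → Poly n
  litP i false = varP i
  litP i true  = constP 1# -P varP i

  -- 1_{x_T = α} = ∏_{i ∈ T} x_i^{(1 - α_i)}
  indP : ∀ {n} → Subset n → Subset n → Poly n
  indP {n} T α = ΠP (allFin n) λ i →
    if lookup T i then litP i (not (lookup α i)) else constP 1#

  IsMultilinearExt : ∀ {k} → (Vec Bool k → Bool) → Poly k → Set ℓ₁
  IsMultilinearExt P P' =
    ∀ β → evalP P' β ≈ (if P β then 1# else 0#)

  data Kind : Set where
    geq eqz : Kind

  PConstraint : ℕ → Set c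
  PConstraint n = Kind × Poly n

  R-sys : ∀ {n k} → Poly k → Instance n k → List (PConstraint n)
  R-sys P' I = map (λ { (cc , S) →
      eqz , (substP P' (λ j → litP (lookup S j) (lookup cc j)) -P constP 1#) }) I

  L-sys : ∀ {n k} → (Vec Bool k → Bool) → Instance n k → List (PConstraint n)
  L-sys {n} {k} P I = concatMap (λ { (cc , S) →
      map (λ f → geq , (ΣP (allFin k) (λ i →
                          litP (lookup S i) (lookup cc i xor lookup f i))
                        -P constP 1#))
          (filter (λ f → B.T? (not (P f))) (allVecs k)) }) I

  -- Families of local distributions.
  -- D S y = probability, under D_S, of the assignment to S whose set of
  -- ones is y (meaningful for y ⊆ S and ∣ S ∣ ≤ℕ r).

  Family : ℕ → Set c
  Family n = Subset n → Subset n → Carrier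

  prob : ∀ {n} → Family n → Subset n → (Subset n → Bool) → Carrier
  prob {n} D S φ = Σl (allVecs n) λ y → if subB y S ∧ φ y then D S y else 0#

  LocallyConsistent : ∀ {n} → ℕ → Family n → Set (ℓ₁ ⊔ ℓ₂)
  LocallyConsistent r D =
    (∀ S → ∣ S ∣ ≤ℕ r → (∀ y → y ⊆ S → 0# ≤F D S y)
                     × (prob D S (λ _ → true) ≈ 1#))
    × (∀ S T → ∣ S ∣ ≤ℕ r → T ⊆ S → ∀ z → z ⊆ T →
         D T z ≈ prob D S (λ y → eqB (y ∩ T) z))

  -- pseudo-expectation, extended by linearity from
  -- E[∏_{i ∈ m} x_i] = D_m(x_m = 1 … 1)
  E : ∀ {n} → Family n → Poly n → Carrier
  E {n} D p = Σl (allVecs n) λ m → p m * D m m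

  Holds : ∀ {n} → Kind → Family n → Poly n → Set (ℓ₁ ⊔ ℓ₂)
  Holds geq D g = Level.Lift ℓ₁ (0# ≤F E D g)
  Holds eqz D g = Level.Lift ℓ₂ (E D g ≈ 0#)

  SA : ∀ {n} → ℕ → List (PConstraint n) → Family n → Set (c ⊔ ℓ₁ ⊔ ℓ₂)
  SA {n} r A D = LocallyConsistent r D ×
    (∀ {κ g} → (κ , g) ∈ A → ∀ T α → DegLe (indP T α *P g) r →
       Holds κ D (indP T α *P g))

  PSD : ∀ {a} {A : Set a} → List A → (A → A → Carrier) → Set (a ⊔ c ⊔ ℓ₂)
  PSD {A = A} idx M = ∀ (v : A → Carrier) → 0# ≤F Σl idx (λ a → Σl idx (λ b → v a * M a b * v b))

  -- index set {0} ∪ ([n] × {0,1}); nothing = 0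
  Idx : ℕ → Set
  Idx n = Maybe (Fin n × Bool)

  allIdx : ∀ n → List (Idx n)
  allIdx n = nothing ∷ concatMap (λ i → just (i , false) ∷ just (i , true) ∷ []) (allFin n)

  Mat : ∀ {n} → Family n → Subset n → Subset n → Idx n → Idx n → Carrier
  Mat D X α nothing nothing = prob D X (λ y → agreeOn X y α)
  Mat D X α nothing (just (i , a)) =
    prob D (⁅ i ⁆ ∪ X) (λ y → eqB (lookup y i ∷ []) (a ∷ []) ∧ agreeOn X y α)
  Mat D X α (just (i , a)) nothing =
    prob D (⁅ i ⁆ ∪ X) (λ y → eqB (lookup y i ∷ []) (a ∷ []) ∧ agreeOn X y α)
  Mat D X α (just (i , a)) (just (j , b)) =
    prob D (⁅ i ⁆ ∪ ⁅ j ⁆ ∪ X)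
      (λ y → eqB (lookup y i ∷ lookup y j ∷ []) (a ∷ b ∷ []) ∧ agreeOn X y α)

  SA₊ : ∀ {n} → ℕ → List (PConstraint n) → Family n → Set (c ⊔ ℓ₁ ⊔ ℓ₂)
  SA₊ {n} r A D = SA r A D × PSD (allIdx n) (Matrix0 D)
    where
    Matrix0 : Family n → Idx n → Idx n → Carrier
    Matrix0 D nothing nothing = 1#
    Matrix0 D nothing (just (i , a)) = prob D ⁅ i ⁆ (λ y → eqB (lookup y i ∷ []) (a ∷ []))
    Matrix0 D (just (i , a)) nothing = prob D ⁅ i ⁆ (λ y → eqB (lookup y i ∷ []) (a ∷ []))
    Matrix0 D (just (i , a)) (just (j , b)) =
      prob D (⁅ i ⁆ ∪ ⁅ j ⁆) (λ y → eqB (lookup y i ∷ lookup y j ∷ []) (a ∷ b ∷ []))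

  StaticLS₊ : ∀ {n} → ℕ → List (PConstraint n) → Family n → Set (c ⊔ ℓ₁ ⊔ ℓ₂)
  StaticLS₊ {n} r A D = SA r A D ×
    (∀ X α → 2 +ℕ ∣ X ∣ ≤ℕ r → PSD (allIdx n) (Mat D X α))

module Submission where

-- Both systems forbid exactly the violating assignments: if V ⊇ S is small and
-- y ⊆ V violates the constraint (c, S), testing it against 1_{x_V = y} gives
-- pseudo-expectation -D_V(y), which must vanish (violated-L, violated-R).  A test
-- 1_{x_T = α} · g of the target system at level r either lives on the window
-- T ∪ S of size ≤ r + k + 1, where its pseudo-expectation is an honest average
-- over D_{T ∪ S} whose violating terms vanish and whose other terms have the
-- right sign (R-from-L, L-from-R), or has |T ∖ S| > r, and then the degree bound
-- forces it to be the zero polynomial (high-degree-vanishes).  The semidefinite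
-- conditions only involve the marginals of D and transfer unchanged.

open import Defs
open import Level using (Level; _⊔_; lift; lower)
open import Data.Nat using (ℕ; zero; suc; _+_; _≤_; _<_; _≤?_; z≤n; s≤s)
open import Data.Nat.Properties
  using (≤-trans; <-≤-trans; ≤⇒≯; m≤m+n; ≰⇒>; +-suc; +-monoˡ-≤) renaming (+-mono-≤ to +-mono-≤ℕ)
open import Data.Bool using (Bool; true; false; if_then_else_; _∧_; _∨_; not; _xor_)
open import Data.Bool.Properties using (∧-zeroʳ; ∧-assoc)
import Data.Bool as Bool
open import Data.Unit using (tt)
open import Data.Empty using (⊥-elim)
open import Data.Sum using (inj₁; inj₂)
open import Data.Product using (_×_; _,_; proj₁; proj₂)
open import Data.Maybe using (nothing; just)
open import Data.Fin using (Fin; zero; suc)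
open import Data.Vec using (Vec; []; _∷_; lookup; tabulate)
open import Data.Vec.Properties
  using (≡-dec; []=⇒lookup; lookup⇒[]=; lookup∘tabulate; tabulate-cong; tabulate∘lookup)
open import Data.List using (List; []; _∷_; _++_; map; foldr; allFin)
import Data.List as List
open import Data.List.Membership.Propositional using (_∈_; lose; find)
open import Data.List.Membership.Propositional.Properties
  using (∈-map⁺; ∈-map⁻; ∈-++⁺ˡ; ∈-++⁺ʳ; ∈-concatMap⁺; ∈-concatMap⁻; ∈-filter⁺; ∈-filter⁻)
open import Data.List.Relation.Unary.Any using (here)
open import Data.Fin.Subset using (Subset; ⁅_⁆; ⊥; _∪_; _∩_; ∣_∣; ∁; _⊆_; _∉_)
  renaming (_∈_ to _∈ₛ_)
open import Data.Fin.Subset.Properties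
  using (_⊆?_; ⊆-refl; ⊆-trans; ⊆-antisym; ⊥⊆; p⊆q⇒∣p∣≤∣q∣; p∩q⊆p; p∩q⊆q; p⊆p∪q; q⊆p∪q;
         x∈p∩q⁺; x∈p∩q⁻; x∈p∪q⁺; x∈p∪q⁻; x∈∁p⇒x∉p; ∪-comm; ∣p∩q∣≤∣p∣; ∣p∣≤∣p∪q∣;
         ∣⊥∣≡0; ∣⁅x⁆∣≡1; x∈⁅x⁆)
open import Relation.Nullary using (Dec; does; proof; yes; no)
open import Relation.Nullary.Reflects using (Reflects; invert)
open import Relation.Nullary.Decidable using (dec-true; does-⇔)
open import Function.Bundles using (mk⇔)
open import Relation.Binary using (IsTotalOrder)
open import Relation.Binary.PropositionalEquality as ≡ using (_≡_; refl; cong; cong₂)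

does-sound : ∀ {a} {A : Set a} (d : Dec A) → does d ≡ true → A
does-sound {A = A} d e = invert (≡.subst (Reflects A) e (proof d))

bool-clash : ∀ {b : Bool} → b ≡ true → b ≡ false → ∀ {a} {A : Set a} → A
bool-clash refl ()

subB-sound : ∀ {n} (a b : Subset n) → subB a b ≡ true → a ⊆ b
subB-sound a b = does-sound (a ⊆? b)

subB-complete : ∀ {n} (a b : Subset n) → a ⊆ b → subB a b ≡ true
subB-complete a b = dec-true (a ⊆? b)

eqB-sound : ∀ {n} (u v : Vec Bool n) → eqB u v ≡ true → u ≡ v
eqB-sound u v = does-sound (≡-dec Bool._≟_ u v)

eqB-refl : ∀ {n} (u : Vec Bool n) → eqB u u ≡ true
eqB-refl u = dec-true (≡-dec Bool._≟_ u u) refl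

eqB-sym : ∀ {n} (u v : Vec Bool n) → eqB u v ≡ eqB v u
eqB-sym u v = does-⇔ (mk⇔ ≡.sym ≡.sym) (≡-dec Bool._≟_ u v) (≡-dec Bool._≟_ v u)

subB-refl : ∀ {n} (a : Subset n) → subB a a ≡ true
subB-refl a = subB-complete a a ⊆-refl

subB-trans : ∀ {n} (a b c : Subset n) → subB a b ≡ true → subB b c ≡ true → subB a c ≡ true
subB-trans a b c ab bc = subB-complete a c (⊆-trans (subB-sound a b ab) (subB-sound b c bc))

subB-⁅⁆ : ∀ {n} (i : Fin n) (b : Subset n) → subB ⁅ i ⁆ b ≡ lookup b i
subB-⁅⁆ zero    (false ∷ b) = refl
subB-⁅⁆ zero    (true ∷ b)  = subB-complete ⊥ b ⊥⊆
subB-⁅⁆ (suc i) (x ∷ b)     = subB-⁅⁆ i b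

subB-∪ : ∀ {n} (a b c : Subset n) → subB (a ∪ b) c ≡ (subB a c ∧ subB b c)
subB-∪ []          []          []          = refl
subB-∪ (false ∷ a) (false ∷ b) (z ∷ c)     = subB-∪ a b c
subB-∪ (false ∷ a) (true ∷ b)  (true ∷ c)  = subB-∪ a b c
subB-∪ (false ∷ a) (true ∷ b)  (false ∷ c) = ≡.sym (∧-zeroʳ (subB a c))
subB-∪ (true ∷ a)  (y ∷ b)     (false ∷ c) = refl
subB-∪ (true ∷ a)  (false ∷ b) (true ∷ c)  = subB-∪ a b c
subB-∪ (true ∷ a)  (true ∷ b)  (true ∷ c)  = subB-∪ a b c

eqB-∩ : ∀ {n} (y m : Subset n) → eqB (y ∩ m) m ≡ subB m y
eqB-∩ []          []          = refl
eqB-∩ (false ∷ y) (false ∷ m) = eqB-∩ y m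
eqB-∩ (true ∷ y)  (false ∷ m) = eqB-∩ y m
eqB-∩ (false ∷ y) (true ∷ m)  = refl
eqB-∩ (true ∷ y)  (true ∷ m)  = eqB-∩ y m

card-∪-diff : ∀ {n} (a b : Subset n) → ∣ a ∪ b ∣ ≤ ∣ a ∩ ∁ b ∣ + ∣ b ∣
card-∪-diff []          []          = z≤n
card-∪-diff (false ∷ a) (false ∷ b) = card-∪-diff a b
card-∪-diff (true ∷ a)  (false ∷ b) = s≤s (card-∪-diff a b)
card-∪-diff (false ∷ a) (true ∷ b)  =
  ≡.subst (suc ∣ a ∪ b ∣ ≤_) (≡.sym (+-suc ∣ a ∩ ∁ b ∣ ∣ b ∣)) (s≤s (card-∪-diff a b))
card-∪-diff (true ∷ a)  (true ∷ b)  =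
  ≡.subst (suc ∣ a ∪ b ∣ ≤_) (≡.sym (+-suc ∣ a ∩ ∁ b ∣ ∣ b ∣)) (s≤s (card-∪-diff a b))

card-∪ : ∀ {n} (a b : Subset n) → ∣ a ∪ b ∣ ≤ ∣ a ∣ + ∣ b ∣
card-∪ a b = ≤-trans (card-∪-diff a b) (+-monoˡ-≤ ∣ b ∣ (∣p∩q∣≤∣p∣ a (∁ b)))

-- This is what makes the coefficients of a
-- product of polynomials in disjoint variables multiply.
Disjoint : ∀ {n} → Subset n → Subset n → Set
Disjoint A B = ∀ {i} → i ∈ₛ A → i ∉ B

restrict-∪ : ∀ {n} {A B x y : Subset n} → Disjoint A B → x ⊆ A → y ⊆ B → (x ∪ y) ∩ A ≡ x
restrict-∪ {x = x} {y} AB x⊆A y⊆B = ⊆-antisym into (λ i∈x → x∈p∩q⁺ (x∈p∪q⁺ (inj₁ i∈x) , x⊆A i∈x))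
  where
  into : (x ∪ y) ∩ _ ⊆ x
  into i∈ with x∈p∩q⁻ (x ∪ y) _ i∈
  ... | i∈x∪y , i∈A with x∈p∪q⁻ x y i∈x∪y
  ...   | inj₁ i∈x = i∈x
  ...   | inj₂ i∈y = ⊥-elim (AB i∈A (y⊆B i∈y))

∪-unique : ∀ {n} {A B a b a' b' : Subset n} → Disjoint A B →
           a' ⊆ A → b' ⊆ B → a ⊆ A → b ⊆ B → a' ∪ b' ≡ a ∪ b → a' ≡ a × b' ≡ b
∪-unique {A = A} {B} {a} {b} {a'} {b'} AB a'A b'B aA bB e = left , right
  where
  open ≡.≡-Reasoning
  BA : Disjoint B A
  BA i∈B i∈A = AB i∈A i∈B
  left : a' ≡ a
  left = begin
    a'             ≡⟨ restrict-∪ AB a'A b'B ⟨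
    (a' ∪ b') ∩ A  ≡⟨ cong (_∩ A) e ⟩
    (a ∪ b) ∩ A    ≡⟨ restrict-∪ AB aA bB ⟩
    a              ∎
  right : b' ≡ b
  right = begin
    b'             ≡⟨ restrict-∪ BA b'B a'A ⟨
    (b' ∪ a') ∩ B  ≡⟨ cong (_∩ B) (∪-comm b' a') ⟩
    (a' ∪ b') ∩ B  ≡⟨ cong (_∩ B) e ⟩
    (a ∪ b) ∩ B    ≡⟨ cong (_∩ B) (∪-comm a b) ⟩
    (b ∪ a) ∩ B    ≡⟨ restrict-∪ BA bB aA ⟩
    b              ∎

bool-≡ : ∀ {u v : Bool} → (u ≡ true → v ≡ true) → (v ≡ true → u ≡ true) → u ≡ v
bool-≡ {false} {false} _ _ = refl
bool-≡ {false} {true}  _ v⇒u = v⇒u refl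
bool-≡ {true}  {false} u⇒v _ = ≡.sym (u⇒v refl)
bool-≡ {true}  {true}  _ _ = refl

∧-true : ∀ {x y} → (x ∧ y) ≡ true → x ≡ true × y ≡ true
∧-true {true} e = refl , e

eqB-∪-split : ∀ {n} {A B a b a' b' : Subset n} → Disjoint A B →
              a' ⊆ A → b' ⊆ B → a ⊆ A → b ⊆ B → eqB (a' ∪ b') (a ∪ b) ≡ (eqB a' a ∧ eqB b' b)
eqB-∪-split {a = a} {b} {a'} {b'} AB a'A b'B aA bB = bool-≡ forward backward
  where
  forward : eqB (a' ∪ b') (a ∪ b) ≡ true → (eqB a' a ∧ eqB b' b) ≡ true
  forward e with ∪-unique AB a'A b'B aA bB (eqB-sound _ _ e)
  ... | refl , refl = cong₂ _∧_ (eqB-refl a) (eqB-refl b)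
  backward : (eqB a' a ∧ eqB b' b) ≡ true → eqB (a' ∪ b') (a ∪ b) ≡ true
  backward e with ∧-true {eqB a' a} e
  ... | ea , eb = ≡.subst₂ (λ u v → eqB (u ∪ v) (a ∪ b) ≡ true)
                   (≡.sym (eqB-sound a' a ea)) (≡.sym (eqB-sound b' b eb)) (eqB-refl (a ∪ b))

⊆⇒∩≡ : ∀ {n} {x V : Subset n} → x ⊆ V → x ∩ V ≡ x
⊆⇒∩≡ {x = x} {V} x⊆V = ⊆-antisym (p∩q⊆p x V) (λ i∈x → x∈p∩q⁺ (i∈x , x⊆V i∈x))

literal : Bool → Bool → Bool
literal x false = x
literal x true  = not x

allF : ∀ {n} → (Fin n → Bool) → Bool
allF {zero}  p = true
allF {suc n} p = p zero ∧ allF (λ i → p (suc i))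

agrees : ∀ {n} → Subset n → Subset n → Subset n → Bool
agrees T α β = allF (λ i → not (lookup T i) ∨ literal (lookup β i) (not (lookup α i)))

agrees-split : ∀ {n} (T α β S : Subset n) → agrees T α β ≡ (agrees (T ∩ ∁ S) α β ∧ agrees (T ∩ S) α β)
agrees-split []          []      []      []          = refl
agrees-split (false ∷ T) (a ∷ α) (x ∷ β) (s ∷ S)     = agrees-split T α β S
agrees-split (true ∷ T)  (a ∷ α) (x ∷ β) (false ∷ S) =
  ≡.trans (cong (literal x (not a) ∧_) (agrees-split T α β S)) (≡.sym (∧-assoc (literal x (not a)) _ _))
agrees-split (true ∷ T)  (a ∷ α) (x ∷ β) (true ∷ S)  =
  ≡.trans (cong (literal x (not a) ∧_) (agrees-split T α β S))
          (∧-left-comm (literal x (not a)) (agrees (T ∩ ∁ S) α β) (agrees (T ∩ S) α β))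
  where
  ∧-left-comm : ∀ u v w → (u ∧ (v ∧ w)) ≡ (v ∧ (u ∧ w))
  ∧-left-comm true  v w = refl
  ∧-left-comm false v w = ≡.sym (∧-zeroʳ v)

agrees-top : ∀ {n} (U α a : Subset n) → subB a U ≡ true → agrees U α a ≡ eqB a (α ∩ U)
agrees-top []          []          []          _ = refl
agrees-top (false ∷ U) (false ∷ α) (false ∷ a) h = agrees-top U α a h
agrees-top (false ∷ U) (true ∷ α)  (false ∷ a) h = agrees-top U α a h
agrees-top (true ∷ U)  (false ∷ α) (false ∷ a) h = agrees-top U α a h
agrees-top (true ∷ U)  (true ∷ α)  (true ∷ a)  h = agrees-top U α a h
agrees-top (true ∷ U)  (false ∷ α) (true ∷ a)  h = refl
agrees-top (true ∷ U)  (true ∷ α)  (false ∷ a) h = refl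
agrees-top (false ∷ U) α           (true ∷ a)  ()

agrees-eq : ∀ {n} (V y y' : Subset n) → subB y V ≡ true → subB y' V ≡ true → agrees V y y' ≡ eqB y' y
agrees-eq V y y' hy hy' = ≡.trans (agrees-top V y y' hy') (cong (eqB y') (⊆⇒∩≡ (subB-sound y V hy)))

scope : ∀ {n k} → Vec (Fin n) k → Subset n
scope []      = ⊥
scope (s ∷ S) = ⁅ s ⁆ ∪ scope S

card-scope : ∀ {n k} (S : Vec (Fin n) k) → ∣ scope S ∣ ≤ k
card-scope {n} []  = ≡.subst (_≤ 0) (≡.sym (∣⊥∣≡0 n)) z≤n
card-scope (s ∷ S) = ≤-trans (card-∪ ⁅ s ⁆ (scope S))
                             (≡.subst (λ m → m + ∣ scope S ∣ ≤ suc _) (≡.sym (∣⁅x⁆∣≡1 s)) (s≤s (card-scope S)))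

∈-scope : ∀ {n k} (S : Vec (Fin n) k) j → lookup S j ∈ₛ scope S
∈-scope (s ∷ S) zero    = x∈p∪q⁺ (inj₁ (x∈⁅x⁆ s))
∈-scope (s ∷ S) (suc j) = x∈p∪q⁺ (inj₂ (∈-scope S j))

allF-all : ∀ {k} (p : Fin k → Bool) → allF p ≡ true → ∀ i → p i ≡ true
allF-all {suc k} p e i with p zero in e₀
allF-all {suc k} p e zero    | true = e₀
allF-all {suc k} p e (suc i) | true = allF-all (λ j → p (suc j)) e i

allF-⊆ : ∀ {n} (m b : Subset n) → allF (λ j → not (lookup m j) ∨ lookup b j) ≡ subB m b
allF-⊆ []          []          = refl
allF-⊆ (false ∷ m) (y ∷ b)     = allF-⊆ m b
allF-⊆ (true ∷ m)  (false ∷ b) = refl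
allF-⊆ (true ∷ m)  (true ∷ b)  = allF-⊆ m b

literal-self : ∀ x c → literal x (c xor literal x c) ≡ false
literal-self false false = refl
literal-self false true  = refl
literal-self true  false = refl
literal-self true  true  = refl

literal-false : ∀ x c f → not (literal x (c xor f)) ≡ true → f ≡ literal x c
literal-false false false false _ = refl
literal-false false true  true  _ = refl
literal-false true  false true  _ = refl
literal-false true  true  false _ = refl
literal-false false false true  ()
literal-false false true  false ()
literal-false true  false false ()
literal-false true  true  true  ()

module _ {c ℓ₁ ℓ₂ : Level} (F : OrderedField c ℓ₁ ℓ₂) where
  open OrderedField F hiding (zero)
    renaming (_+_ to _⊕_; refl to ≈-refl; sym to ≈-sym; trans to ≈-trans; reflexive to ≈-reflexive)
  open import Algebra.Properties.Ring ring using (-‿distribˡ-*; -‿involutive; -0#≈0#; -‿+-comm; -1*x≈-x)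
  open import Algebra.Properties.CommutativeSemigroup +-commutativeSemigroup using () renaming (interchange to +-interchange)
  open import Algebra.Properties.CommutativeSemigroup *-commutativeSemigroup using () renaming (interchange to *-interchange)
  open import Relation.Binary.Reasoning.Setoid setoid
  private module ≤ = IsTotalOrder isTotalOrder

  ≤-resp : ∀ {a b x y} → a ≈ x → b ≈ y → a ≤F b → x ≤F y
  ≤-resp a≈x b≈y a≤b = ≤.≤-respˡ-≈ a≈x (≤.≤-respʳ-≈ b≈y a≤b)

  0≤+ : ∀ {a b} → 0# ≤F a → 0# ≤F b → 0# ≤F a ⊕ b
  0≤+ {a} {b} 0≤a 0≤b = ≤.trans 0≤b (≤-resp (+-identityˡ b) ≈-refl (+-mono-≤ b 0≤a))

  ≈0⇒0≤ : ∀ {a} → a ≈ 0# → 0# ≤F a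
  ≈0⇒0≤ a≈0 = ≤.reflexive (≈-sym a≈0)

  nonneg-antisym : ∀ {a} → 0# ≤F a → 0# ≤F - a → a ≈ 0#
  nonneg-antisym {a} 0≤a 0≤-a =
    ≤.antisym (≤-resp (+-identityˡ a) (-‿inverseˡ a) (+-mono-≤ a 0≤-a)) 0≤a

  -1²≈1 : (- 1#) * (- 1#) ≈ 1#
  -1²≈1 = begin
    (- 1#) * (- 1#)  ≈⟨ -‿distribˡ-* 1# (- 1#) ⟨
    - (1# * (- 1#))  ≈⟨ -‿cong (*-identityˡ (- 1#)) ⟩
    - (- 1#)         ≈⟨ -‿involutive 1# ⟩
    1#               ∎

  -- 1 ≥ 0, since otherwise 0 ≤ -1 and then 0 ≤ (-1)·(-1) = 1.
  0≤1 : 0# ≤F 1#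
  0≤1 with ≤.total 0# 1#
  ... | inj₁ 0≤1 = 0≤1
  ... | inj₂ 1≤0 = ≤-resp ≈-refl -1²≈1 (*-nonneg 0≤-1 0≤-1)
    where
    0≤-1 : 0# ≤F - 1#
    0≤-1 = ≤-resp (-‿inverseʳ 1#) (+-identityˡ (- 1#)) (+-mono-≤ (- 1#) 1≤0)

  Σ : ∀ {a} {A : Set a} → List A → (A → Carrier) → Carrier
  Σ = Σl F

  Σ-cong : ∀ {a} {A : Set a} (xs : List A) {f g : A → Carrier} → (∀ x → f x ≈ g x) → Σ xs f ≈ Σ xs g
  Σ-cong []       f≈g = ≈-refl
  Σ-cong (x ∷ xs) f≈g = +-cong (f≈g x) (Σ-cong xs f≈g)

  Σ-zero : ∀ {a} {A : Set a} (xs : List A) {f : A → Carrier} → (∀ x → f x ≈ 0#) → Σ xs f ≈ 0#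
  Σ-zero []       f≈0 = ≈-refl
  Σ-zero (x ∷ xs) f≈0 = ≈-trans (+-cong (f≈0 x) (Σ-zero xs f≈0)) (+-identityˡ 0#)

  Σ-nonneg : ∀ {a} {A : Set a} (xs : List A) {f : A → Carrier} → (∀ x → 0# ≤F f x) → 0# ≤F Σ xs f
  Σ-nonneg []       0≤f = ≤.refl
  Σ-nonneg (x ∷ xs) 0≤f = 0≤+ (0≤f x) (Σ-nonneg xs 0≤f)

  Σ-++ : ∀ {a} {A : Set a} (xs ys : List A) (f : A → Carrier) → Σ (xs ++ ys) f ≈ Σ xs f ⊕ Σ ys f
  Σ-++ []       ys f = ≈-sym (+-identityˡ _)
  Σ-++ (x ∷ xs) ys f = ≈-trans (+-cong ≈-refl (Σ-++ xs ys f)) (≈-sym (+-assoc _ _ _))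

  Σ-map : ∀ {a b} {A : Set a} {B : Set b} (g : A → B) (xs : List A) (f : B → Carrier) →
          Σ (map g xs) f ≡ Σ xs (λ x → f (g x))
  Σ-map g []       f = refl
  Σ-map g (x ∷ xs) f = cong (f (g x) ⊕_) (Σ-map g xs f)

  Σ-+ : ∀ {a} {A : Set a} (xs : List A) (f g : A → Carrier) → Σ xs (λ x → f x ⊕ g x) ≈ Σ xs f ⊕ Σ xs g
  Σ-+ []       f g = ≈-sym (+-identityˡ 0#)
  Σ-+ (x ∷ xs) f g = ≈-trans (+-cong ≈-refl (Σ-+ xs f g)) (+-interchange _ _ _ _)

  Σ-neg : ∀ {a} {A : Set a} (xs : List A) (f : A → Carrier) → - Σ xs f ≈ Σ xs (λ x → - f x)
  Σ-neg []       f = -0#≈0#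
  Σ-neg (x ∷ xs) f = ≈-trans (≈-sym (-‿+-comm _ _)) (+-cong ≈-refl (Σ-neg xs f))

  Σ-*ˡ : ∀ {a} {A : Set a} (xs : List A) (k : Carrier) (f : A → Carrier) → k * Σ xs f ≈ Σ xs (λ x → k * f x)
  Σ-*ˡ []       k f = zeroʳ k
  Σ-*ˡ (x ∷ xs) k f = ≈-trans (distribˡ k _ _) (+-cong ≈-refl (Σ-*ˡ xs k f))

  Σ-*ʳ : ∀ {a} {A : Set a} (xs : List A) (k : Carrier) (f : A → Carrier) → Σ xs f * k ≈ Σ xs (λ x → f x * k)
  Σ-*ʳ xs k f = ≈-trans (*-comm _ k) (≈-trans (Σ-*ˡ xs k f) (Σ-cong xs (λ x → *-comm k (f x))))

  Σ-≡ : ∀ {a} {A : Set a} (xs : List A) {f g : A → Carrier} → (∀ x → f x ≡ g x) → Σ xs f ≡ Σ xs g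
  Σ-≡ []       f≡g = refl
  Σ-≡ (x ∷ xs) f≡g = ≡.cong₂ _⊕_ (f≡g x) (Σ-≡ xs f≡g)

  Σ-swap : ∀ {a b} {A : Set a} {B : Set b} (xs : List A) (ys : List B) (f : A → B → Carrier) →
           Σ xs (λ x → Σ ys (f x)) ≈ Σ ys (λ y → Σ xs (λ x → f x y))
  Σ-swap []       ys f = ≈-sym (Σ-zero ys (λ _ → ≈-refl))
  Σ-swap (x ∷ xs) ys f = ≈-trans (+-cong ≈-refl (Σ-swap xs ys f)) (≈-sym (Σ-+ ys (f x) _))

  Π : ∀ {a} {A : Set a} → List A → (A → Carrier) → Carrier
  Π xs f = foldr (λ x acc → f x * acc) 1# xs

  Π-cong : ∀ {a} {A : Set a} (xs : List A) {f g : A → Carrier} → (∀ x → f x ≈ g x) → Π xs f ≈ Π xs g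
  Π-cong []       f≈g = ≈-refl
  Π-cong (x ∷ xs) f≈g = *-cong (f≈g x) (Π-cong xs f≈g)

  ⟦_⟧ : Bool → Carrier
  ⟦ b ⟧ = if b then 1# else 0#

  0≤⟦⟧ : ∀ b → 0# ≤F ⟦ b ⟧
  0≤⟦⟧ true  = 0≤1
  0≤⟦⟧ false = ≤.refl

  ⟦⟧-* : ∀ b x → ⟦ b ⟧ * x ≈ (if b then x else 0#)
  ⟦⟧-* true  x = *-identityˡ x
  ⟦⟧-* false x = zeroˡ x

  ⟦⟧-∧ : ∀ a b → ⟦ a ∧ b ⟧ ≈ ⟦ a ⟧ * ⟦ b ⟧
  ⟦⟧-∧ true  b = ≈-sym (*-identityˡ _)
  ⟦⟧-∧ false b = ≈-sym (zeroˡ _)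

  if-zero : ∀ b {x} → x ≈ 0# → (if b then x else 0#) ≈ 0#
  if-zero true  x≈0 = x≈0
  if-zero false x≈0 = ≈-refl

  if-cong : ∀ b {x y} → x ≈ y → (if b then x else 0#) ≈ (if b then y else 0#)
  if-cong true  x≈y = x≈y
  if-cong false x≈y = ≈-refl

  if-* : ∀ b x y → (if b then x else 0#) * y ≈ (if b then x * y else 0#)
  if-* true  x y = ≈-refl
  if-* false x y = zeroˡ y

  *-if : ∀ b x y → x * (if b then y else 0#) ≈ (if b then x * y else 0#)
  *-if true  x y = ≈-refl
  *-if false x y = zeroʳ x

  if-+ : ∀ b x y → (if b then x ⊕ y else 0#) ≈ (if b then x else 0#) ⊕ (if b then y else 0#)
  if-+ true  x y = ≈-refl
  if-+ false x y = ≈-sym (+-identityˡ 0#)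

  if-neg : ∀ b x → (if b then - x else 0#) ≈ - (if b then x else 0#)
  if-neg true  x = ≈-refl
  if-neg false x = ≈-sym -0#≈0#

  if-∧ : ∀ a b x → (if a then (if b then x else 0#) else 0#) ≡ (if a ∧ b then x else 0#)
  if-∧ true  b x = refl
  if-∧ false b x = refl

  if-swap : ∀ a b x → (if a then (if b then x else 0#) else 0#) ≡ (if b then (if a then x else 0#) else 0#)
  if-swap true  true  x = refl
  if-swap true  false x = refl
  if-swap false true  x = refl
  if-swap false false x = refl

  if-Σ : ∀ {a} {A : Set a} b (xs : List A) (f : A → Carrier) →
         (if b then Σ xs f else 0#) ≈ Σ xs (λ x → if b then f x else 0#)
  if-Σ true  xs f = ≈-refl
  if-Σ false xs f = ≈-sym (Σ-zero xs (λ _ → ≈-refl))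

  Σ-allVecs-suc : ∀ n (f : Vec Bool (suc n) → Carrier) →
                  Σ (allVecs (suc n)) f ≈ Σ (allVecs n) (λ a → f (false ∷ a)) ⊕ Σ (allVecs n) (λ a → f (true ∷ a))
  Σ-allVecs-suc n f = ≈-trans (Σ-++ (map (false ∷_) (allVecs n)) _ f)
                              (+-cong (≈-reflexive (Σ-map _ (allVecs n) f)) (≈-reflexive (Σ-map _ (allVecs n) f)))

  Σ-allFin-suc : ∀ {m} (f : Fin (suc m) → Carrier) → Σ (allFin (suc m)) f ≡ f zero ⊕ Σ (allFin m) (λ i → f (suc i))
  Σ-allFin-suc {m} f = cong (f zero ⊕_) (shift (λ i → i))
    where
    shift : ∀ {j} (h : Fin j → Fin m) → Σ (List.tabulate (λ i → suc (h i))) f ≡ Σ (List.tabulate h) (λ i → f (suc i))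
    shift {zero}  h = refl
    shift {suc j} h = cong (f (suc (h zero)) ⊕_) (shift (λ i → h (suc i)))

  Π-allFin-suc : ∀ {m} (f : Fin (suc m) → Carrier) → Π (allFin (suc m)) f ≡ f zero * Π (allFin m) (λ i → f (suc i))
  Π-allFin-suc {m} f = cong (f zero *_) (shift (λ i → i))
    where
    shift : ∀ {j} (h : Fin j → Fin m) → Π (List.tabulate (λ i → suc (h i))) f ≡ Π (List.tabulate h) (λ i → f (suc i))
    shift {zero}  h = refl
    shift {suc j} h = cong (f (suc (h zero)) *_) (shift (λ i → h (suc i)))

  Π-⟦⟧ : ∀ {n} (p : Fin n → Bool) → Π (allFin n) (λ i → ⟦ p i ⟧) ≈ ⟦ allF p ⟧
  Π-⟦⟧ {zero}  p = ≈-refl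
  Π-⟦⟧ {suc n} p = begin
    Π (allFin (suc n)) (λ i → ⟦ p i ⟧)            ≡⟨ Π-allFin-suc (λ i → ⟦ p i ⟧) ⟩
    ⟦ p zero ⟧ * Π (allFin n) (λ i → ⟦ p (suc i) ⟧) ≈⟨ *-cong ≈-refl (Π-⟦⟧ (λ i → p (suc i))) ⟩
    ⟦ p zero ⟧ * ⟦ allF (λ i → p (suc i)) ⟧          ≈⟨ ⟦⟧-∧ (p zero) _ ⟨
    ⟦ allF p ⟧                                      ∎

  Σ-δ : ∀ {n} (v : Vec Bool n) (g : Vec Bool n → Carrier) → Σ (allVecs n) (λ a → if eqB a v then g a else 0#) ≈ g v
  Σ-δ []               g = +-identityʳ _
  Σ-δ {suc n} (false ∷ v) g = ≈-trans (Σ-allVecs-suc n _)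
    (≈-trans (+-cong (Σ-δ v (λ a → g (false ∷ a))) (Σ-zero (allVecs n) (λ _ → ≈-refl))) (+-identityʳ _))
  Σ-δ {suc n} (true ∷ v)  g = ≈-trans (Σ-allVecs-suc n _)
    (≈-trans (+-cong (Σ-zero (allVecs n) (λ _ → ≈-refl)) (Σ-δ v (λ a → g (true ∷ a)))) (+-identityˡ _))

  Σ-δ' : ∀ {n} (v : Vec Bool n) (g : Vec Bool n → Carrier) → Σ (allVecs n) (λ a → if eqB v a then g a else 0#) ≈ g v
  Σ-δ' v g = ≈-trans (Σ-cong (allVecs _) (λ a → ≈-reflexive (cong (λ b → if b then g a else 0#) (eqB-sym v a)))) (Σ-δ v g)

  -- Evaluation of multilinear polynomials at points of {0,1}^n is a ring
  -- homomorphism (this is where x_i² = x_i is used).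
  infixl 7 _·_
  _·_ : ∀ {n} → Poly F n → Poly F n → Poly F n
  _·_ = _*P_ F

  eval : ∀ {n} → Poly F n → Vec Bool n → Carrier
  eval = evalP F

  eval-const : ∀ {n} (a : Carrier) (β : Vec Bool n) → eval (constP F a) β ≈ a
  eval-const {n} a β = begin
      Σ (allVecs n) (λ m → if subB m β then constP F a m else 0#)
    ≡⟨ Σ-≡ (allVecs n) (λ m → if-swap (subB m β) (eqB m ⊥) a) ⟩
      Σ (allVecs n) (λ m → if eqB m ⊥ then (if subB m β then a else 0#) else 0#)
    ≈⟨ Σ-δ ⊥ (λ m → if subB m β then a else 0#) ⟩
      (if subB ⊥ β then a else 0#)
    ≡⟨ cong (λ b → if b then a else 0#) (subB-complete ⊥ β ⊥⊆) ⟩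
      a ∎

  eval-var : ∀ {n} (i : Fin n) (β : Vec Bool n) → eval (varP F i) β ≈ ⟦ lookup β i ⟧
  eval-var {n} i β = begin
      Σ (allVecs n) (λ m → if subB m β then varP F i m else 0#)
    ≡⟨ Σ-≡ (allVecs n) (λ m → if-swap (subB m β) (eqB m ⁅ i ⁆) 1#) ⟩
      Σ (allVecs n) (λ m → if eqB m ⁅ i ⁆ then ⟦ subB m β ⟧ else 0#)
    ≈⟨ Σ-δ ⁅ i ⁆ (λ m → ⟦ subB m β ⟧) ⟩
      ⟦ subB ⁅ i ⁆ β ⟧
    ≡⟨ cong ⟦_⟧ (subB-⁅⁆ i β) ⟩
      ⟦ lookup β i ⟧ ∎

  eval-+ : ∀ {n} (p q : Poly F n) β → eval (_+P_ F p q) β ≈ eval p β ⊕ eval q β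
  eval-+ {n} p q β = ≈-trans (Σ-cong (allVecs n) (λ m → if-+ (subB m β) (p m) (q m))) (Σ-+ (allVecs n) _ _)

  eval-- : ∀ {n} (p q : Poly F n) β → eval (_-P_ F p q) β ≈ eval p β ⊕ - eval q β
  eval-- {n} p q β = begin
    Σ V (λ m → if subB m β then p m - q m else 0#)
      ≈⟨ Σ-cong V (λ m → if-+ (subB m β) (p m) (- q m)) ⟩
    Σ V (λ m → (if subB m β then p m else 0#) ⊕ (if subB m β then - q m else 0#))
      ≈⟨ Σ-+ V _ _ ⟩
    eval p β ⊕ Σ V (λ m → if subB m β then - q m else 0#)
      ≈⟨ +-cong ≈-refl (Σ-cong V (λ m → if-neg (subB m β) (q m))) ⟩
    eval p β ⊕ Σ V (λ m → - (if subB m β then q m else 0#))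
      ≈⟨ +-cong ≈-refl (Σ-neg V _) ⟨
    eval p β ⊕ - eval q β ∎
    where V = allVecs n

  eval-scale : ∀ {n} (a : Carrier) (p : Poly F n) β → eval (scaleP F a p) β ≈ a * eval p β
  eval-scale {n} a p β = ≈-trans (Σ-cong (allVecs n) (λ m → ≈-sym (*-if (subB m β) a (p m)))) (≈-sym (Σ-*ˡ (allVecs n) a _))

  eval-· : ∀ {n} (p q : Poly F n) β → eval (p · q) β ≈ eval p β * eval q β
  eval-· {n} p q β = begin
      Σ V (λ m → if subB m β then Σ V (λ a → Σ V (λ b → X a b m)) else 0#)
    ≈⟨ Σ-cong V (λ m → ≈-trans (if-Σ (subB m β) V _) (Σ-cong V (λ a → if-Σ (subB m β) V _))) ⟩
      Σ V (λ m → Σ V (λ a → Σ V (λ b → if subB m β then X a b m else 0#)))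
    ≈⟨ Σ-swap V V _ ⟩
      Σ V (λ a → Σ V (λ m → Σ V (λ b → if subB m β then X a b m else 0#)))
    ≈⟨ Σ-cong V (λ a → Σ-swap V V _) ⟩
      Σ V (λ a → Σ V (λ b → Σ V (λ m → if subB m β then X a b m else 0#)))
    ≈⟨ Σ-cong V (λ a → Σ-cong V (λ b → collapse a b)) ⟩
      Σ V (λ a → Σ V (λ b → (if subB a β then p a else 0#) * (if subB b β then q b else 0#)))
    ≈⟨ Σ-cong V (λ a → ≈-sym (Σ-*ˡ V _ _)) ⟩
      Σ V (λ a → (if subB a β then p a else 0#) * eval q β)
    ≈⟨ Σ-*ʳ V _ _ ⟨
      eval p β * eval q β ∎
    where
    V : List (Vec Bool n)
    V = allVecs n
    X : Subset n → Subset n → Subset n → Carrier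
    X a b m = if eqB (a ∪ b) m then p a * q b else 0#
    guard-* : ∀ x y u v → (if x ∧ y then u * v else 0#) ≈ (if x then u else 0#) * (if y then v else 0#)
    guard-* true  true  u v = ≈-refl
    guard-* true  false u v = ≈-sym (zeroʳ u)
    guard-* false y     u v = ≈-sym (zeroˡ _)
    -- a ∪ b ⊆ β iff a ⊆ β and b ⊆ β
    collapse : ∀ a b → Σ V (λ m → if subB m β then X a b m else 0#)
                       ≈ (if subB a β then p a else 0#) * (if subB b β then q b else 0#)
    collapse a b = begin
      Σ V (λ m → if subB m β then X a b m else 0#)
        ≡⟨ Σ-≡ V (λ m → if-swap (subB m β) (eqB (a ∪ b) m) _) ⟩
      Σ V (λ m → if eqB (a ∪ b) m then (if subB m β then p a * q b else 0#) else 0#)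
        ≈⟨ Σ-δ' (a ∪ b) (λ m → if subB m β then p a * q b else 0#) ⟩
      (if subB (a ∪ b) β then p a * q b else 0#)
        ≡⟨ cong (λ z → if z then p a * q b else 0#) (subB-∪ a b β) ⟩
      (if subB a β ∧ subB b β then p a * q b else 0#)
        ≈⟨ guard-* _ _ _ _ ⟩
      (if subB a β then p a else 0#) * (if subB b β then q b else 0#) ∎

  eval-ΣP : ∀ {a n} {A : Set a} (xs : List A) (f : A → Poly F n) β → eval (ΣP F xs f) β ≈ Σ xs (λ x → eval (f x) β)
  eval-ΣP []       f β = eval-const 0# β
  eval-ΣP (x ∷ xs) f β = ≈-trans (eval-+ (f x) _ β) (+-cong ≈-refl (eval-ΣP xs f β))

  eval-ΠP : ∀ {a n} {A : Set a} (xs : List A) (f : A → Poly F n) β → eval (ΠP F xs f) β ≈ Π xs (λ x → eval (f x) β)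
  eval-ΠP []       f β = eval-const 1# β
  eval-ΠP (x ∷ xs) f β = ≈-trans (eval-· (f x) _ β) (*-cong ≈-refl (eval-ΠP xs f β))

  eval-lit : ∀ {n} (i : Fin n) b β → eval (litP F i b) β ≈ ⟦ literal (lookup β i) b ⟧
  eval-lit i false β = eval-var i β
  eval-lit i true  β = ≈-trans (eval-- (constP F 1#) (varP F i) β)
                               (≈-trans (+-cong (eval-const 1# β) (-‿cong (eval-var i β))) (one-minus (lookup β i)))
    where
    one-minus : ∀ x → 1# ⊕ - ⟦ x ⟧ ≈ ⟦ not x ⟧
    one-minus true  = -‿inverseʳ 1#
    one-minus false = ≈-trans (+-cong ≈-refl -0#≈0#) (+-identityʳ 1#)

  eval-ind : ∀ {n} (T α β : Subset n) → eval (indP F T α) β ≈ ⟦ agrees T α β ⟧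
  eval-ind {n} T α β = ≈-trans (eval-ΠP (allFin n) _ β)
    (≈-trans (Π-cong (allFin n) (λ i → factor (lookup T i) i))
             (Π-⟦⟧ (λ i → not (lookup T i) ∨ literal (lookup β i) (not (lookup α i)))))
    where
    factor : ∀ t i → eval (if t then litP F i (not (lookup α i)) else constP F 1#) β
                     ≈ ⟦ not t ∨ literal (lookup β i) (not (lookup α i)) ⟧
    factor true  i = eval-lit i (not (lookup α i)) β
    factor false i = eval-const 1# β

  Supp : ∀ {n} → Subset n → Poly F n → Set ℓ₁
  Supp W p = ∀ m → subB m W ≡ false → p m ≈ 0#

  supp-const : ∀ {n} (W : Subset n) a → Supp W (constP F a)
  supp-const W a m m⊈W with eqB m ⊥ in e
  ... | false = ≈-refl
  ... | true  = bool-clash (≡.subst (λ z → subB z W ≡ true) (≡.sym (eqB-sound m ⊥ e)) (subB-complete ⊥ W ⊥⊆)) m⊈W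

  supp-var : ∀ {n} (W : Subset n) i → i ∈ₛ W → Supp W (varP F i)
  supp-var W i i∈W m m⊈W with eqB m ⁅ i ⁆ in e
  ... | false = ≈-refl
  ... | true  = bool-clash (≡.subst (λ z → subB z W ≡ true) (≡.sym (eqB-sound m ⁅ i ⁆ e))
                  (≡.trans (subB-⁅⁆ i W) ([]=⇒lookup i∈W))) m⊈W

  supp-+ : ∀ {n} (W : Subset n) p q → Supp W p → Supp W q → Supp W (_+P_ F p q)
  supp-+ W p q sp sq m m⊈W = ≈-trans (+-cong (sp m m⊈W) (sq m m⊈W)) (+-identityˡ 0#)

  supp-- : ∀ {n} (W : Subset n) p q → Supp W p → Supp W q → Supp W (_-P_ F p q)
  supp-- W p q sp sq m m⊈W = ≈-trans (+-cong (sp m m⊈W) (≈-trans (-‿cong (sq m m⊈W)) -0#≈0#)) (+-identityˡ 0#)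

  supp-scale : ∀ {n} (W : Subset n) a p → Supp W p → Supp W (scaleP F a p)
  supp-scale W a p sp m m⊈W = ≈-trans (*-cong ≈-refl (sp m m⊈W)) (zeroʳ a)

  supp-· : ∀ {n} (W : Subset n) p q → Supp W p → Supp W q → Supp W (p · q)
  supp-· {n} W p q sp sq m m⊈W = Σ-zero (allVecs n) (λ a → Σ-zero (allVecs n) (λ b → term a b))
    where
    term : ∀ a b → (if eqB (a ∪ b) m then p a * q b else 0#) ≈ 0#
    term a b with eqB (a ∪ b) m in e | subB a W in ea | subB b W in eb
    ... | false | _     | _     = ≈-refl
    ... | true  | false | _     = ≈-trans (*-cong (sp a ea) ≈-refl) (zeroˡ _)
    ... | true  | true  | false = ≈-trans (*-cong ≈-refl (sq b eb)) (zeroʳ _)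
    ... | true  | true  | true  = bool-clash (≡.subst (λ z → subB z W ≡ true) (eqB-sound (a ∪ b) m e)
                                    (≡.trans (subB-∪ a b W) (≡.cong₂ _∧_ ea eb))) m⊈W

  supp-ΣP : ∀ {a n} {A : Set a} (W : Subset n) (xs : List A) f → (∀ x → Supp W (f x)) → Supp W (ΣP F xs f)
  supp-ΣP W []       f sf = supp-const W 0#
  supp-ΣP W (x ∷ xs) f sf = supp-+ W _ _ (sf x) (supp-ΣP W xs f sf)

  supp-ΠP : ∀ {a n} {A : Set a} (W : Subset n) (xs : List A) f → (∀ x → Supp W (f x)) → Supp W (ΠP F xs f)
  supp-ΠP W []       f sf = supp-const W 1#
  supp-ΠP W (x ∷ xs) f sf = supp-· W _ _ (sf x) (supp-ΠP W xs f sf)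

  supp-lit : ∀ {n} (W : Subset n) i b → i ∈ₛ W → Supp W (litP F i b)
  supp-lit W i false i∈W = supp-var W i i∈W
  supp-lit W i true  i∈W = supp-- W _ _ (supp-const W 1#) (supp-var W i i∈W)

  supp-mono : ∀ {n} (A B : Subset n) p → subB A B ≡ true → Supp A p → Supp B p
  supp-mono A B p A⊆B sp m m⊈B with subB m A in e
  ... | false = sp m e
  ... | true  = bool-clash (subB-trans m A B e A⊆B) m⊈B

  supp-ind : ∀ {n} (T α : Subset n) → Supp T (indP F T α)
  supp-ind {n} T α = supp-ΠP T (allFin n) _ (λ i → factor i (lookup T i) refl)
    where
    factor : ∀ i t → lookup T i ≡ t → Supp T (if t then litP F i (not (lookup α i)) else constP F 1#)
    factor i true  e = supp-lit T i (not (lookup α i)) (lookup⇒[]= i T e)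
    factor i false e = supp-const T 1#

  supp-deg : ∀ {n} (V : Subset n) (R : ℕ) p → ∣ V ∣ ≤ R → Supp V p → DegLe F p R
  supp-deg V R p ∣V∣≤R sp m R<∣m∣ with subB m V in e
  ... | false = sp m e
  ... | true  = ⊥-elim (≤⇒≯ (≤-trans (p⊆q⇒∣p∣≤∣q∣ (subB-sound m V e)) ∣V∣≤R) R<∣m∣)

  -- Möbius inversion on the Boolean lattice: a multilinear polynomial is
  -- recovered from its values on {0,1}^n by
  --     p_m = Σ_{a ⊆ m} μ m a · p(a),   μ m a = (-1)^{|m ∖ a|}.
  -- Hence evaluation is injective, and coefficients can be computed from values.
  sign : Bool → Bool → Carrier
  sign true false = - 1#
  sign _    _     = 1#

  μ : ∀ {n} → Subset n → Subset n → Carrier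
  μ []      []      = 1#
  μ (x ∷ m) (y ∷ a) = sign x y * μ m a

  μ-sq : ∀ {n} (m a : Subset n) → μ m a * μ m a ≈ 1#
  μ-sq []      []      = *-identityˡ 1#
  μ-sq (x ∷ m) (y ∷ a) = ≈-trans (*-interchange _ _ _ _) (≈-trans (*-cong (sign-sq x y) (μ-sq m a)) (*-identityˡ 1#))
    where
    sign-sq : ∀ x y → sign x y * sign x y ≈ 1#
    sign-sq true  false = -1²≈1
    sign-sq true  true  = *-identityˡ 1#
    sign-sq false y     = *-identityˡ 1#

  μ-sum : ∀ {n} (m b : Subset n) → Σ (allVecs n) (λ a → if subB a m ∧ subB b a then μ m a else 0#) ≈ ⟦ eqB b m ⟧
  μ-sum []      []      = +-identityʳ 1#
  μ-sum {suc n} (x ∷ m) (z ∷ b) = ≈-trans (Σ-allVecs-suc n _) (by-heads x z)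
    where
    V : List (Vec Bool n)
    V = allVecs n
    K : Carrier
    K = Σ V (λ a → if subB a m ∧ subB b a then μ m a else 0#)
    Part : Bool → Bool → Bool → Carrier
    Part x z h = Σ V (λ a → if subB (h ∷ a) (x ∷ m) ∧ subB (z ∷ b) (h ∷ a) then μ (x ∷ m) (h ∷ a) else 0#)
    tail-sum : ∀ s → Σ V (λ a → if subB a m ∧ subB b a then s * μ m a else 0#) ≈ s * K
    tail-sum s = ≈-trans (Σ-cong V (λ a → ≈-sym (*-if (subB a m ∧ subB b a) s (μ m a)))) (≈-sym (Σ-*ˡ V s _))
    unsigned : Σ V (λ a → if subB a m ∧ subB b a then 1# * μ m a else 0#) ≈ ⟦ eqB b m ⟧
    unsigned = ≈-trans (tail-sum 1#) (≈-trans (*-identityˡ K) (μ-sum m b))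
    empty : ∀ {t : Subset n → Carrier} → Σ V (λ a → if subB a m ∧ false then t a else 0#) ≈ 0#
    empty = Σ-zero V (λ a → guard-false (subB a m))
      where guard-false : ∀ u {t} → (if u ∧ false then t else 0#) ≈ 0#
            guard-false true  = ≈-refl
            guard-false false = ≈-refl
    zeros : Σ V (λ _ → 0#) ≈ 0#
    zeros = Σ-zero V (λ _ → ≈-refl)
    by-heads : ∀ x z → Part x z false ⊕ Part x z true ≈ ⟦ eqB (z ∷ b) (x ∷ m) ⟧
    by-heads false false = ≈-trans (+-cong unsigned zeros) (+-identityʳ _)
    by-heads false true  = ≈-trans (+-cong empty zeros) (+-identityʳ _)
    by-heads true  true  = ≈-trans (+-cong empty unsigned) (+-identityˡ _)
    by-heads true  false = begin
      Part true false false ⊕ Part true false true  ≈⟨ +-cong (tail-sum (- 1#)) (tail-sum 1#) ⟩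
      - 1# * K ⊕ 1# * K                             ≈⟨ distribʳ K (- 1#) 1# ⟨
      (- 1# ⊕ 1#) * K                               ≈⟨ *-cong (-‿inverseˡ 1#) ≈-refl ⟩
      0# * K                                        ≈⟨ zeroˡ K ⟩
      0#                                            ∎

  coefficient : ∀ {n} (p : Poly F n) (m : Subset n) → p m ≈ Σ (allVecs n) (λ a → if subB a m then μ m a * eval p a else 0#)
  coefficient {n} p m = ≈-sym (begin
      Σ V (λ a → if subB a m then μ m a * Σ V (λ b → if subB b a then p b else 0#) else 0#)
    ≈⟨ Σ-cong V (λ a → ≈-trans (if-cong (subB a m) (Σ-*ˡ V _ _))
                        (≈-trans (if-Σ (subB a m) V _) (Σ-cong V (λ b → regroup (subB a m) (subB b a) _ _)))) ⟩
      Σ V (λ a → Σ V (λ b → (if subB a m ∧ subB b a then μ m a else 0#) * p b))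
    ≈⟨ Σ-swap V V _ ⟩
      Σ V (λ b → Σ V (λ a → (if subB a m ∧ subB b a then μ m a else 0#) * p b))
    ≈⟨ Σ-cong V (λ b → ≈-trans (≈-sym (Σ-*ʳ V _ _)) (≈-trans (*-cong (μ-sum m b) ≈-refl) (⟦⟧-* _ _))) ⟩
      Σ V (λ b → if eqB b m then p b else 0#)
    ≈⟨ Σ-δ m p ⟩
      p m ∎)
    where
    V : List (Vec Bool n)
    V = allVecs n
    regroup : ∀ u v s x → (if u then s * (if v then x else 0#) else 0#) ≈ (if u ∧ v then s else 0#) * x
    regroup true  true  s x = ≈-refl
    regroup true  false s x = ≈-trans (zeroʳ s) (≈-sym (zeroˡ x))
    regroup false v     s x = ≈-sym (zeroˡ x)

  eval-injective : ∀ {n} (p q : Poly F n) → (∀ β → eval p β ≈ eval q β) → ∀ m → p m ≈ q m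
  eval-injective {n} p q p≈q m = ≈-trans (coefficient p m)
    (≈-trans (Σ-cong (allVecs n) (λ a → if-cong (subB a m) (*-cong ≈-refl (p≈q a)))) (≈-sym (coefficient q m)))

  ·-zeroʳ : ∀ {n} (p h : Poly F n) → (∀ b → h b ≈ 0#) → ∀ m → (p · h) m ≈ 0#
  ·-zeroʳ {n} p h h≈0 m = Σ-zero (allVecs n) (λ a → Σ-zero (allVecs n) (λ b →
    if-zero (eqB (a ∪ b) m) (≈-trans (*-cong ≈-refl (h≈0 b)) (zeroʳ (p a)))))

  ind-top : ∀ {n} (U α : Subset n) → indP F U α U ≈ μ U (α ∩ U)
  ind-top {n} U α = ≈-trans (coefficient (indP F U α) U) (≈-trans (Σ-cong (allVecs n) term) (Σ-δ (α ∩ U) (μ U)))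
    where
    term : ∀ a → (if subB a U then μ U a * eval (indP F U α) a else 0#) ≈ (if eqB a (α ∩ U) then μ U a else 0#)
    term a with subB a U in a⊆U
    ... | true  = ≈-trans (*-cong ≈-refl (eval-ind U α a)) (≈-trans (*-comm _ _) (≈-trans (⟦⟧-* _ _)
                    (≈-reflexive (cong (λ z → if z then μ U a else 0#) (agrees-top U α a a⊆U)))))
    ... | false with eqB a (α ∩ U) in e
    ...   | false = ≈-refl
    ...   | true  = bool-clash (≡.subst (λ z → subB z U ≡ true) (≡.sym (eqB-sound a (α ∩ U) e))
                      (subB-complete (α ∩ U) U (p∩q⊆q α U))) a⊆U

  coefficient-· : ∀ {n} (A B : Subset n) (p h : Poly F n) → Disjoint A B → Supp A p → Supp B h →
                  ∀ a b → subB a A ≡ true → subB b B ≡ true → (p · h) (a ∪ b) ≈ p a * h b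
  coefficient-· {n} A B p h AB sp sh a b a⊆A b⊆B = begin
      Σ V (λ a' → Σ V (λ b' → if eqB (a' ∪ b') (a ∪ b) then p a' * h b' else 0#))
    ≈⟨ Σ-cong V (λ a' → ≈-trans (Σ-cong V (λ b' → term a' b')) (≈-sym (if-Σ (eqB a' a) V _))) ⟩
      Σ V (λ a' → if eqB a' a then Σ V (λ b' → if eqB b' b then p a' * h b' else 0#) else 0#)
    ≈⟨ Σ-δ a _ ⟩
      Σ V (λ b' → if eqB b' b then p a * h b' else 0#)
    ≈⟨ Σ-δ b _ ⟩
      p a * h b ∎
    where
    V : List (Vec Bool n)
    V = allVecs n
    both-zero : ∀ a' b' → p a' * h b' ≈ 0# → (if eqB (a' ∪ b') (a ∪ b) then p a' * h b' else 0#)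
                                         ≈ (if eqB a' a then (if eqB b' b then p a' * h b' else 0#) else 0#)
    both-zero a' b' z = ≈-trans (if-zero (eqB (a' ∪ b') (a ∪ b)) z) (≈-sym (if-zero (eqB a' a) (if-zero (eqB b' b) z)))
    -- outside A × B both sides vanish; inside, a' ∪ b' = a ∪ b iff a' = a and b' = b
    term : ∀ a' b' → (if eqB (a' ∪ b') (a ∪ b) then p a' * h b' else 0#)
                     ≈ (if eqB a' a then (if eqB b' b then p a' * h b' else 0#) else 0#)
    term a' b' with subB a' A in a'⊆A | subB b' B in b'⊆B
    ... | false | _     = both-zero a' b' (≈-trans (*-cong (sp a' a'⊆A) ≈-refl) (zeroˡ _))
    ... | true  | false = both-zero a' b' (≈-trans (*-cong ≈-refl (sh b' b'⊆B)) (zeroʳ _))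
    ... | true  | true  = ≈-reflexive (≡.trans
          (cong (λ z → if z then p a' * h b' else 0#)
                (eqB-∪-split AB (subB-sound a' A a'⊆A) (subB-sound b' B b'⊆B) (subB-sound a A a⊆A) (subB-sound b B b⊆B)))
          (≡.sym (if-∧ (eqB a' a) (eqB b' b) _)))

  -- If g involves only the variables in S and the set T
  -- has more than r variables outside S, then 1_{x_T = α} · g can have degree
  -- ≤ r only by being the zero polynomial: writing U = T ∖ S, the coefficient
  -- of x_U · x_b in it is ±(1_{x_{T∩S} = α} · g)_b, and |U ∪ b| > r.
  ind-split : ∀ {n} (T α S : Subset n) (g : Poly F n) →
              ∀ m → (indP F T α · g) m ≈ (indP F (T ∩ ∁ S) α · (indP F (T ∩ S) α · g)) m
  ind-split {n} T α S g = eval-injective _ _ (λ β → begin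
      eval (indP F T α · g) β
    ≈⟨ eval-· _ _ β ⟩
      eval (indP F T α) β * eval g β
    ≈⟨ *-cong (≈-trans (eval-ind T α β) (≈-reflexive (cong ⟦_⟧ (agrees-split T α β S)))) ≈-refl ⟩
      ⟦ agrees U α β ∧ agrees Ts α β ⟧ * eval g β
    ≈⟨ *-cong (⟦⟧-∧ (agrees U α β) (agrees Ts α β)) ≈-refl ⟩
      (⟦ agrees U α β ⟧ * ⟦ agrees Ts α β ⟧) * eval g β
    ≈⟨ *-assoc _ _ _ ⟩
      ⟦ agrees U α β ⟧ * (⟦ agrees Ts α β ⟧ * eval g β)
    ≈⟨ *-cong (eval-ind U α β) (≈-trans (eval-· _ _ β) (*-cong (eval-ind Ts α β) ≈-refl)) ⟨
      eval (indP F U α) β * eval (indP F Ts α · g) β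
    ≈⟨ eval-· _ _ β ⟨
      eval (indP F U α · (indP F Ts α · g)) β ∎)
    where
    U : Subset n
    U = T ∩ ∁ S
    Ts : Subset n
    Ts = T ∩ S

  high-degree-vanishes : ∀ {n} (T α S : Subset n) (g : Poly F n) (r : ℕ) → Supp S g → r < ∣ T ∩ ∁ S ∣ →
                         DegLe F (indP F T α · g) r → ∀ m → (indP F T α · g) m ≈ 0#
  high-degree-vanishes {n} T α S g r sg r<∣U∣ deg m =
    ≈-trans (ind-split T α S g m) (·-zeroʳ (indP F U α) h h≈0 m)
    where
    U : Subset n
    U = T ∩ ∁ S
    h : Poly F n
    h = indP F (T ∩ S) α · g
    s : Carrier
    s = μ U (α ∩ U)
    supp-h : Supp S h
    supp-h = supp-· S _ _ (supp-mono (T ∩ S) S _ (subB-complete (T ∩ S) S (p∩q⊆q T S)) (supp-ind (T ∩ S) α)) sg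
    U∩S=∅ : Disjoint U S
    U∩S=∅ i∈U = x∈∁p⇒x∉p (proj₂ (x∈p∩q⁻ T (∁ S) i∈U))
    h≈0 : ∀ b → h b ≈ 0#
    h≈0 b with subB b S in b⊆S
    ... | false = supp-h b b⊆S
    ... | true  = begin
        h b                ≈⟨ *-identityˡ (h b) ⟨
        1# * h b           ≈⟨ *-cong (μ-sq U (α ∩ U)) ≈-refl ⟨
        (s * s) * h b      ≈⟨ *-assoc s s (h b) ⟩
        s * (s * h b)      ≈⟨ *-cong ≈-refl top-term ⟩
        s * 0#             ≈⟨ zeroʳ s ⟩
        0#                 ∎
      where
      -- the coefficient of U ∪ b, which has degree > r
      top-term : s * h b ≈ 0#
      top-term = begin
        s * h b                              ≈⟨ *-cong (ind-top U α) ≈-refl ⟨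
        indP F U α U * h b                   ≈⟨ coefficient-· U S _ h U∩S=∅ (supp-ind U α) supp-h U b (subB-refl U) b⊆S ⟨
        (indP F U α · h) (U ∪ b)             ≈⟨ ind-split T α S g (U ∪ b) ⟨
        (indP F T α · g) (U ∪ b)             ≈⟨ deg (U ∪ b) (<-≤-trans r<∣U∣ (∣p∣≤∣p∪q∣ U b)) ⟩
        0#                                   ∎

  lc-mono : ∀ {n R R'} (D : Family F n) → R' ≤ R → LocallyConsistent F R D → LocallyConsistent F R' D
  lc-mono D R'≤R (distributions , marginals) =
      (λ S ∣S∣≤R' → distributions S (≤-trans ∣S∣≤R' R'≤R))
    , (λ S T ∣S∣≤R' → marginals S T (≤-trans ∣S∣≤R' R'≤R))

  E-local : ∀ {n R} (D : Family F n) (V : Subset n) (p : Poly F n) → LocallyConsistent F R D → ∣ V ∣ ≤ R → Supp V p →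
            E F D p ≈ Σ (allVecs n) (λ y → if subB y V then D V y * eval p y else 0#)
  E-local {n} D V p (_ , marginals) ∣V∣≤R sp = begin
      Σ W (λ m → p m * D m m)
    ≈⟨ Σ-cong W marginal ⟩
      Σ W (λ m → Σ W (λ y → if subB y V ∧ subB m y then p m * D V y else 0#))
    ≈⟨ Σ-swap W W _ ⟩
      Σ W (λ y → Σ W (λ m → if subB y V ∧ subB m y then p m * D V y else 0#))
    ≈⟨ Σ-cong W regroup ⟩
      Σ W (λ y → if subB y V then D V y * eval p y else 0#) ∎
    where
    W : List (Vec Bool n)
    W = allVecs n
    -- D_m(x_m = 1…1) is the D_V-probability that y ⊇ m (for m ⊆ V)
    marginal : ∀ m → p m * D m m ≈ Σ W (λ y → if subB y V ∧ subB m y then p m * D V y else 0#)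
    marginal m with subB m V in m⊆V
    ... | true = begin
        p m * D m m
      ≈⟨ *-cong ≈-refl (marginals V m ∣V∣≤R (subB-sound m V m⊆V) m ⊆-refl) ⟩
        p m * Σ W (λ y → if subB y V ∧ eqB (y ∩ m) m then D V y else 0#)
      ≈⟨ Σ-*ˡ W (p m) _ ⟩
        Σ W (λ y → p m * (if subB y V ∧ eqB (y ∩ m) m then D V y else 0#))
      ≈⟨ Σ-cong W (λ y → ≈-trans (*-if _ (p m) (D V y))
                          (≈-reflexive (cong (λ z → if subB y V ∧ z then p m * D V y else 0#) (eqB-∩ y m)))) ⟩
        Σ W (λ y → if subB y V ∧ subB m y then p m * D V y else 0#) ∎
    ... | false = ≈-trans (≈-trans (*-cong (sp m m⊆V) ≈-refl) (zeroˡ _)) (≈-sym (Σ-zero W outside))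
      where
      outside : ∀ y → (if subB y V ∧ subB m y then p m * D V y else 0#) ≈ 0#
      outside y with subB y V in y⊆V | subB m y in m⊆y
      ... | false | _     = ≈-refl
      ... | true  | false = ≈-refl
      ... | true  | true  = bool-clash (subB-trans m y V m⊆y y⊆V) m⊆V
    regroup : ∀ y → Σ W (λ m → if subB y V ∧ subB m y then p m * D V y else 0#) ≈ (if subB y V then D V y * eval p y else 0#)
    regroup y = begin
        Σ W (λ m → if subB y V ∧ subB m y then p m * D V y else 0#)
      ≡⟨ Σ-≡ W (λ m → ≡.sym (if-∧ (subB y V) (subB m y) _)) ⟩
        Σ W (λ m → if subB y V then (if subB m y then p m * D V y else 0#) else 0#)
      ≈⟨ if-Σ (subB y V) W _ ⟨
        (if subB y V then Σ W (λ m → if subB m y then p m * D V y else 0#) else 0#)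
      ≈⟨ if-cong (subB y V) (≈-trans (Σ-cong W (λ m → ≈-sym (if-* (subB m y) (p m) (D V y))))
                                     (≈-trans (≈-sym (Σ-*ʳ W _ _)) (*-comm _ _))) ⟩
        (if subB y V then D V y * eval p y else 0#) ∎

  E-point : ∀ {n R} (D : Family F n) (V y : Subset n) (g : Poly F n) → LocallyConsistent F R D → ∣ V ∣ ≤ R →
            Supp V g → subB y V ≡ true → E F D (indP F V y · g) ≈ D V y * eval g y
  E-point {n} D V y g lc ∣V∣≤R sg y⊆V =
    ≈-trans (E-local D V _ lc ∣V∣≤R (supp-· V _ _ (supp-ind V y) sg))
            (≈-trans (Σ-cong (allVecs n) term) (Σ-δ y (λ y' → D V y' * eval g y')))
    where
    -- inside V, the indicator 1_{x_V = y} is the Kronecker delta at y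
    eval-test : ∀ y' → subB y' V ≡ true → eval (indP F V y · g) y' ≈ (if eqB y' y then eval g y' else 0#)
    eval-test y' y'⊆V = begin
      eval (indP F V y · g) y'                    ≈⟨ eval-· _ _ y' ⟩
      eval (indP F V y) y' * eval g y'            ≈⟨ *-cong (eval-ind V y y') ≈-refl ⟩
      ⟦ agrees V y y' ⟧ * eval g y'               ≈⟨ ⟦⟧-* _ _ ⟩
      (if agrees V y y' then eval g y' else 0#)   ≡⟨ cong (λ z → if z then eval g y' else 0#) (agrees-eq V y y' y⊆V y'⊆V) ⟩
      (if eqB y' y then eval g y' else 0#)        ∎
    term : ∀ y' → (if subB y' V then D V y' * eval (indP F V y · g) y' else 0#)
                  ≈ (if eqB y' y then D V y' * eval g y' else 0#)
    term y' with subB y' V in y'⊆V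
    ... | true  = ≈-trans (*-cong ≈-refl (eval-test y' y'⊆V)) (*-if _ _ _)
    ... | false with eqB y' y in e
    ...   | false = ≈-refl
    ...   | true  = bool-clash (≡.subst (λ z → subB z V ≡ true) (≡.sym (eqB-sound y' y e)) y⊆V) y'⊆V

  E-zero : ∀ {n} (D : Family F n) (p : Poly F n) → (∀ m → p m ≈ 0#) → E F D p ≈ 0#
  E-zero {n} D p p≈0 = Σ-zero (allVecs n) (λ m → ≈-trans (*-cong (p≈0 m) ≈-refl) (zeroˡ _))

  one≤Σ⟦⟧ : ∀ {m} (d : Fin m → Bool) → allF (λ i → not (d i)) ≡ false → 1# ≤F Σ (allFin m) (λ i → ⟦ d i ⟧)
  one≤Σ⟦⟧ {suc m} d some-true =
    ≤-resp ≈-refl (≈-reflexive (≡.sym (Σ-allFin-suc (λ i → ⟦ d i ⟧)))) (by-head (d zero) some-true)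
    where
    rest : Carrier
    rest = Σ (allFin m) (λ i → ⟦ d (suc i) ⟧)
    by-head : ∀ b → (not b ∧ allF (λ i → not (d (suc i)))) ≡ false → 1# ≤F ⟦ b ⟧ ⊕ rest
    by-head true  _ = ≤-resp (+-identityˡ 1#) (+-comm _ _) (+-mono-≤ 1# (Σ-nonneg (allFin m) (λ i → 0≤⟦⟧ (d (suc i)))))
    by-head false e = ≤-resp ≈-refl (≈-sym (+-identityˡ _)) (one≤Σ⟦⟧ (λ i → d (suc i)) e)

  eval-subst : ∀ {k n} (P' : Poly F k) (q : Fin k → Poly F n) (b : Vec Bool k) β →
               (∀ j → eval (q j) β ≈ ⟦ lookup b j ⟧) → eval (substP F P' q) β ≈ evalP F P' b
  eval-subst {k} P' q b β q≈b = begin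
      eval (substP F P' q) β
    ≈⟨ eval-ΣP (allVecs k) _ β ⟩
      Σ (allVecs k) (λ m → eval (scaleP F (P' m) (ΠP F (allFin k) (λ j → if lookup m j then q j else constP F 1#))) β)
    ≈⟨ Σ-cong (allVecs k) (λ m → ≈-trans (eval-scale (P' m) _ β) (*-cong ≈-refl (monomial m))) ⟩
      Σ (allVecs k) (λ m → P' m * ⟦ allF (λ j → not (lookup m j) ∨ lookup b j) ⟧)
    ≈⟨ Σ-cong (allVecs k) (λ m → ≈-trans (*-comm _ _) (≈-trans (⟦⟧-* _ _)
                                    (≈-reflexive (cong (λ z → if z then P' m else 0#) (allF-⊆ m b))))) ⟩
      evalP F P' b ∎
    where
    factor : ∀ t j → eval (if t then q j else constP F 1#) β ≈ ⟦ not t ∨ lookup b j ⟧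
    factor true  j = q≈b j
    factor false j = eval-const 1# β
    monomial : ∀ m → eval (ΠP F (allFin k) (λ j → if lookup m j then q j else constP F 1#)) β
                     ≈ ⟦ allF (λ j → not (lookup m j) ∨ lookup b j) ⟧
    monomial m = ≈-trans (eval-ΠP (allFin k) _ β)
                   (≈-trans (Π-cong (allFin k) (λ j → factor (lookup m j) j)) (Π-⟦⟧ (λ j → not (lookup m j) ∨ lookup b j)))

  Satisfies : ∀ {n} → ℕ → List (PConstraint F n) → Family F n → Set (c ⊔ ℓ₁ ⊔ ℓ₂)
  Satisfies R A D = ∀ {κ g} → (κ , g) ∈ A → ∀ T α → DegLe F (indP F T α · g) R → Holds F κ D (indP F T α · g)

  module Transfer {n k : ℕ} (P : Vec Bool k → Bool) (P' : Poly F k) (P'-ext : IsMultilinearExt F P P')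
                  (I : Instance n k) (D : Family F n) where

    gR : Vec Bool k → Vec (Fin n) k → Poly F n
    gR c S = _-P_ F (substP F P' (λ j → litP F (lookup S j) (lookup c j))) (constP F 1#)

    gL : Vec Bool k → Vec (Fin n) k → Vec Bool k → Poly F n
    gL c S f = _-P_ F (ΣP F (allFin k) (λ i → litP F (lookup S i) (lookup c i xor lookup f i))) (constP F 1#)

    input : Vec Bool k → Vec (Fin n) k → Subset n → Vec Bool k
    input c S y = tabulate (λ j → literal (lookup y (lookup S j)) (lookup c j))

    eval-gR : ∀ c S β → eval (gR c S) β ≈ ⟦ P (input c S β) ⟧ ⊕ - 1#
    eval-gR c S β = ≈-trans (eval-- _ _ β) (+-cong (≈-trans (eval-subst P' _ (input c S β) β lit) (P'-ext (input c S β)))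
                                                   (-‿cong (eval-const 1# β)))
      where
      lit : ∀ j → eval (litP F (lookup S j) (lookup c j)) β ≈ ⟦ lookup (input c S β) j ⟧
      lit j = ≈-trans (eval-lit (lookup S j) (lookup c j) β) (≈-reflexive (cong ⟦_⟧ (≡.sym (lookup∘tabulate _ j))))

    eval-gL : ∀ c S f β →
              eval (gL c S f) β ≈ Σ (allFin k) (λ i → ⟦ literal (lookup β (lookup S i)) (lookup c i xor lookup f i) ⟧) ⊕ - 1#
    eval-gL c S f β = ≈-trans (eval-- _ _ β)
      (+-cong (≈-trans (eval-ΣP (allFin k) _ β) (Σ-cong (allFin k) (λ i → eval-lit (lookup S i) (lookup c i xor lookup f i) β)))
              (-‿cong (eval-const 1# β)))

    supp-gR : ∀ c S → Supp (scope S) (gR c S)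
    supp-gR c S = supp-- _ _ _ (supp-ΣP _ (allVecs k) _ (λ m → supp-scale _ (P' m) _ (supp-ΠP _ (allFin k) _ (λ j →
                                 factor (lookup m j) j))))
                               (supp-const _ 1#)
      where
      factor : ∀ t j → Supp (scope S) (if t then litP F (lookup S j) (lookup c j) else constP F 1#)
      factor true  j = supp-lit _ (lookup S j) (lookup c j) (∈-scope S j)
      factor false j = supp-const _ 1#

    supp-gL : ∀ c S f → Supp (scope S) (gL c S f)
    supp-gL c S f = supp-- _ _ _ (supp-ΣP _ (allFin k) _ (λ i → supp-lit _ (lookup S i) (lookup c i xor lookup f i) (∈-scope S i)))
                                 (supp-const _ 1#)

    allVecs-complete : ∀ {m} (v : Vec Bool m) → v ∈ allVecs m
    allVecs-complete []          = here refl
    allVecs-complete {suc m} (false ∷ v) = ∈-++⁺ˡ (∈-map⁺ (false ∷_) (allVecs-complete v))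
    allVecs-complete {suc m} (true ∷ v)  = ∈-++⁺ʳ (map (false ∷_) (allVecs m)) (∈-map⁺ (true ∷_) (allVecs-complete v))

    ∈-R-sys : ∀ {c S} → (c , S) ∈ I → (eqz , gR c S) ∈ R-sys F P' I
    ∈-R-sys c,S∈I = ∈-map⁺ _ c,S∈I

    ∈-L-sys : ∀ {c S} → (c , S) ∈ I → ∀ f → P f ≡ false → (geq , gL c S f) ∈ L-sys F P I
    ∈-L-sys c,S∈I f Pf≡false = ∈-concatMap⁺ _ (lose c,S∈I (∈-map⁺ _
      (∈-filter⁺ (λ f → Bool.T? (not (P f))) (allVecs-complete f) (≡.subst (λ z → Bool.T (not z)) (≡.sym Pf≡false) tt))))

    -- Either constraint system forbids the violating assignments: if V ⊇ S is
    -- small and y ⊆ V violates the constraint (c, S), then D_V(y) = 0.  Testing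
    -- the constraint against 1_{x_V = y} gives E = D_V(y)·(0 - 1) = -D_V(y).
    E-violated : ∀ {R} → LocallyConsistent F R D → ∀ V y (g : Poly F n) → ∣ V ∣ ≤ R → Supp V g → subB y V ≡ true →
                 eval g y ≈ 0# ⊕ - 1# → E F D (indP F V y · g) ≈ - D V y
    E-violated lc V y g ∣V∣≤R sg y⊆V g[y]≈-1 = begin
      E F D (indP F V y · g)  ≈⟨ E-point D V y g lc ∣V∣≤R sg y⊆V ⟩
      D V y * eval g y        ≈⟨ *-cong ≈-refl (≈-trans g[y]≈-1 (+-identityˡ _)) ⟩
      D V y * - 1#            ≈⟨ *-comm _ _ ⟩
      - 1# * D V y            ≈⟨ -1*x≈-x (D V y) ⟩
      - D V y                 ∎

    test-degree : ∀ {R} V y (g : Poly F n) → ∣ V ∣ ≤ R → Supp V g → DegLe F (indP F V y · g) R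
    test-degree V y g ∣V∣≤R sg = supp-deg V _ _ ∣V∣≤R (supp-· V _ _ (supp-ind V y) sg)

    violated-L : ∀ {R} → LocallyConsistent F R D → Satisfies R (L-sys F P I) D → ∀ {c S} → (c , S) ∈ I →
                 ∀ V y → ∣ V ∣ ≤ R → subB (scope S) V ≡ true → subB y V ≡ true →
                 P (input c S y) ≡ false → D V y ≈ 0#
    violated-L lc sat {c} {S} c,S∈I V y ∣V∣≤R S⊆V y⊆V violated =
      nonneg-antisym (proj₁ (proj₁ lc V ∣V∣≤R) y (subB-sound y V y⊆V))
                     (≤-resp ≈-refl (E-violated lc V y g ∣V∣≤R sg y⊆V g[y]) test)
      where
      f : Vec Bool k
      f = input c S y
      g : Poly F n
      g = gL c S f
      sg : Supp V g
      sg = supp-mono (scope S) V g S⊆V (supp-gL c S f)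
      test : 0# ≤F E F D (indP F V y · g)
      test = lower (sat (∈-L-sys c,S∈I f violated) V y (test-degree V y g ∣V∣≤R sg))
      literal-false-at-y : ∀ i → ⟦ literal (lookup y (lookup S i)) (lookup c i xor lookup f i) ⟧ ≈ 0#
      literal-false-at-y i = ≈-reflexive (cong ⟦_⟧ (≡.trans
        (cong (λ z → literal (lookup y (lookup S i)) (lookup c i xor z)) (lookup∘tabulate _ i))
        (literal-self (lookup y (lookup S i)) (lookup c i))))
      g[y] : eval g y ≈ 0# ⊕ - 1#
      g[y] = ≈-trans (eval-gL c S f y) (+-cong (Σ-zero (allFin k) literal-false-at-y) ≈-refl)

    violated-R : ∀ {R} → LocallyConsistent F R D → Satisfies R (R-sys F P' I) D → ∀ {c S} → (c , S) ∈ I →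
                 ∀ V y → ∣ V ∣ ≤ R → subB (scope S) V ≡ true → subB y V ≡ true →
                 P (input c S y) ≡ false → D V y ≈ 0#
    violated-R lc sat {c} {S} c,S∈I V y ∣V∣≤R S⊆V y⊆V violated = begin
        D V y        ≈⟨ -‿involutive _ ⟨
        - (- D V y)  ≈⟨ -‿cong (≈-trans (≈-sym (E-violated lc V y g ∣V∣≤R sg y⊆V g[y])) test) ⟩
        - 0#         ≈⟨ -0#≈0# ⟩
        0#           ∎
      where
      g : Poly F n
      g = gR c S
      sg : Supp V g
      sg = supp-mono (scope S) V g S⊆V (supp-gR c S)
      test : E F D (indP F V y · g) ≈ 0#
      test = lower (sat (∈-R-sys c,S∈I) V y (test-degree V y g ∣V∣≤R sg))
      g[y] : eval g y ≈ 0# ⊕ - 1#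
      g[y] = ≈-trans (eval-gR c S y) (+-cong (≈-reflexive (cong ⟦_⟧ violated)) ≈-refl)

    module AtLevel (r : ℕ) where
      window : Subset n → Vec (Fin n) k → Subset n
      window T S = T ∪ scope S

      scope⊆window : ∀ T S → subB (scope S) (window T S) ≡ true
      scope⊆window T S = subB-complete (scope S) _ (q⊆p∪q T (scope S))

      window-size : ∀ T S → ∣ T ∩ ∁ (scope S) ∣ ≤ r → ∣ window T S ∣ ≤ r + k + 1
      window-size T S ∣T∖S∣≤r =
        ≤-trans (card-∪-diff T (scope S)) (≤-trans (+-mono-≤ℕ ∣T∖S∣≤r (card-scope S)) (m≤m+n (r + k) 1))

      supp-window : ∀ T α S g → Supp (scope S) g → Supp (window T S) (indP F T α · g)
      supp-window T α S g sg = supp-· _ _ _ (supp-mono T _ _ (subB-complete T _ (p⊆p∪q (scope S))) (supp-ind T α))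
                                            (supp-mono (scope S) _ _ (scope⊆window T S) sg)

      E-window : ∀ T α S g → LocallyConsistent F (r + k + 1) D → Supp (scope S) g → ∣ T ∩ ∁ (scope S) ∣ ≤ r →
                 E F D (indP F T α · g)
                 ≈ Σ (allVecs n) (λ y → if subB y (window T S) then D (window T S) y * (⟦ agrees T α y ⟧ * eval g y) else 0#)
      E-window T α S g lc sg small =
        ≈-trans (E-local D _ _ lc (window-size T S small) (supp-window T α S g sg))
                (Σ-cong (allVecs n) (λ y → if-cong (subB y _) (*-cong ≈-refl (eval-ind-· y))))
        where
        eval-ind-· : ∀ y → eval (indP F T α · g) y ≈ ⟦ agrees T α y ⟧ * eval g y
        eval-ind-· y = ≈-trans (eval-· _ _ y) (*-cong (eval-ind T α y) ≈-refl)

      R-from-L : LocallyConsistent F (r + k + 1) D → Satisfies (r + k + 1) (L-sys F P I) D →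
                 ∀ {c S} → (c , S) ∈ I → ∀ T α → DegLe F (indP F T α · gR c S) r → E F D (indP F T α · gR c S) ≈ 0#
      R-from-L lc sat {c} {S} c,S∈I T α deg with ∣ T ∩ ∁ (scope S) ∣ ≤? r
      ... | no  large = E-zero D _ (high-degree-vanishes T α (scope S) (gR c S) r (supp-gR c S) (≰⇒> large) deg)
      ... | yes small = ≈-trans (E-window T α S (gR c S) lc (supp-gR c S) small) (Σ-zero (allVecs n) term)
        where
        V : Subset n
        V = window T S
        term : ∀ y → (if subB y V then D V y * (⟦ agrees T α y ⟧ * eval (gR c S) y) else 0#) ≈ 0#
        term y with subB y V in y⊆V
        ... | false = ≈-refl
        ... | true  = ≈-trans (*-cong ≈-refl (*-cong ≈-refl (eval-gR c S y))) (by-cases (agrees T α y) (P (input c S y)) refl)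
          where
          -- satisfied: g(y) = 0;  violated: D_V(y) = 0
          by-cases : ∀ a b → P (input c S y) ≡ b → D V y * (⟦ a ⟧ * (⟦ b ⟧ ⊕ - 1#)) ≈ 0#
          by-cases false b    _ = ≈-trans (*-cong ≈-refl (zeroˡ _)) (zeroʳ _)
          by-cases true  true _ = ≈-trans (*-cong ≈-refl (≈-trans (*-identityˡ _) (-‿inverseʳ 1#))) (zeroʳ _)
          by-cases true  false violated = ≈-trans (*-cong D≈0 ≈-refl) (zeroˡ _)
            where
            D≈0 : D V y ≈ 0#
            D≈0 = violated-L lc sat c,S∈I V y (window-size T S small) (scope⊆window T S) y⊆V violated

      L-from-R : LocallyConsistent F (r + k + 1) D → Satisfies (r + k + 1) (R-sys F P' I) D →
                 ∀ {c S} → (c , S) ∈ I → ∀ f → P f ≡ false → ∀ T α → DegLe F (indP F T α · gL c S f) r →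
                 0# ≤F E F D (indP F T α · gL c S f)
      L-from-R lc sat {c} {S} c,S∈I f Pf≡false T α deg with ∣ T ∩ ∁ (scope S) ∣ ≤? r
      ... | no  large = ≈0⇒0≤ (E-zero D _ (high-degree-vanishes T α (scope S) (gL c S f) r (supp-gL c S f) (≰⇒> large) deg))
      ... | yes small = ≤-resp ≈-refl (≈-sym (E-window T α S (gL c S f) lc (supp-gL c S f) small)) (Σ-nonneg (allVecs n) term)
        where
        V : Subset n
        V = window T S
        d : Subset n → Fin k → Bool
        d y i = literal (lookup y (lookup S i)) (lookup c i xor lookup f i)
        term : ∀ y → 0# ≤F (if subB y V then D V y * (⟦ agrees T α y ⟧ * eval (gL c S f) y) else 0#)
        term y with subB y V in y⊆V
        ... | false = ≤.refl
        ... | true  = ≤-resp ≈-refl (≈-sym (*-cong ≈-refl (*-cong ≈-refl (eval-gL c S f y))))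
                             (by-cases (agrees T α y) (allF (λ i → not (d y i))) refl)
          where
          D≥0 : 0# ≤F D V y
          D≥0 = proj₁ (proj₁ lc V (window-size T S small)) y (subB-sound y V y⊆V)
          -- some literal true: g(y) ≥ 0;  all literals false: y is excluded, D_V(y) = 0
          by-cases : ∀ a b → allF (λ i → not (d y i)) ≡ b →
                     0# ≤F D V y * (⟦ a ⟧ * (Σ (allFin k) (λ i → ⟦ d y i ⟧) ⊕ - 1#))
          by-cases false b _ = ≈0⇒0≤ (≈-trans (*-cong ≈-refl (zeroˡ _)) (zeroʳ _))
          by-cases true false some-true = *-nonneg D≥0 (≤-resp ≈-refl (≈-sym (*-identityˡ _))
                                            (≤-resp (-‿inverseʳ 1#) ≈-refl (+-mono-≤ (- 1#) (one≤Σ⟦⟧ (d y) some-true))))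
          by-cases true true  all-false = ≈0⇒0≤ (≈-trans (*-cong D≈0 ≈-refl) (zeroˡ _))
            where
            input≡f : input c S y ≡ f
            input≡f = ≡.trans (tabulate-cong (λ i → ≡.sym (literal-false (lookup y (lookup S i)) (lookup c i) (lookup f i)
                                                           (allF-all (λ i → not (d y i)) all-false i))))
                              (tabulate∘lookup f)
            D≈0 : D V y ≈ 0#
            D≈0 = violated-R lc sat c,S∈I V y (window-size T S small) (scope⊆window T S) y⊆V
                             (≡.trans (cong P input≡f) Pf≡false)

      r≤r+k+1 : r ≤ r + k + 1
      r≤r+k+1 = ≤-trans (m≤m+n r k) (m≤m+n (r + k) 1)

      SA-R-from-L : SA F (r + k + 1) (L-sys F P I) D → SA F r (R-sys F P' I) D
      SA-R-from-L (lc , sat) = lc-mono D r≤r+k+1 lc , satisfies-R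
        where
        satisfies-R : Satisfies r (R-sys F P' I) D
        satisfies-R g∈R T α deg with ∈-map⁻ _ g∈R
        ... | _ , c,S∈I , refl = lift (R-from-L lc sat c,S∈I T α deg)

      SA-L-from-R : SA F (r + k + 1) (R-sys F P' I) D → SA F r (L-sys F P I) D
      SA-L-from-R (lc , sat) = lc-mono D r≤r+k+1 lc , satisfies-L
        where
        excluded : ∀ {f} → f ∈ List.filter (λ f → Bool.T? (not (P f))) (allVecs k) → P f ≡ false
        excluded {f} f∈F with P f | proj₂ (∈-filter⁻ (λ f → Bool.T? (not (P f))) {xs = allVecs k} f∈F)
        ... | false | _ = refl
        satisfies-L : Satisfies r (L-sys F P I) D
        satisfies-L g∈L T α deg with find (∈-concatMap⁻ _ {xs = I} g∈L)
        ... | _ , c,S∈I , g∈clauses with ∈-map⁻ _ g∈clauses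
        ...   | f , f∈F , refl = lift (L-from-R lc sat c,S∈I f (excluded f∈F) T α deg)

  -- The semidefiniteness conditions only involve the low-order marginals of D,
  -- not the constraint system: SA₊ and static LS₊ transfer whenever SA does.
  PSD-cong : ∀ {a} {A : Set a} (idx : List A) (M M' : A → A → Carrier) →
             (∀ i j → M i j ≡ M' i j) → PSD F idx M → PSD F idx M'
  PSD-cong idx M M' M≡M' psd v =
    ≡.subst (0# ≤F_) (Σ-≡ idx (λ i → Σ-≡ idx (λ j → cong (λ z → v i * z * v j) (M≡M' i j)))) (psd v)

  SA₊-transfer : ∀ {n R R'} {A A' : List (PConstraint F n)} {D : Family F n} →
                 (SA F R A D → SA F R' A' D) → SA₊ F R A D → SA₊ F R' A' D
  SA₊-transfer {n} SA-transfer (sa , psd) = SA-transfer sa , PSD-cong (allIdx F n) _ _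
    (λ { nothing nothing → refl ; nothing (just _) → refl ; (just _) nothing → refl ; (just _) (just _) → refl }) psd

  StaticLS₊-transfer : ∀ {n R R'} {A A' : List (PConstraint F n)} {D : Family F n} → R' ≤ R →
                       (SA F R A D → SA F R' A' D) → StaticLS₊ F R A D → StaticLS₊ F R' A' D
  StaticLS₊-transfer R'≤R SA-transfer (sa , psd) = SA-transfer sa , λ X α 2+∣X∣≤R' → psd X α (≤-trans 2+∣X∣≤R' R'≤R)

-- Lemma 2.3.
lemma2p3 : {c ℓ₁ ℓ₂ : Level} (F : OrderedField c ℓ₁ ℓ₂) {n k : ℕ} (r : ℕ) → k ≤ r →
    (P : Vec Bool k → Bool) (P' : Poly F k) → IsMultilinearExt F P P' →
    (I : Instance n k) (D : Family F n) →
      ((SA F (r + k + 1) (L-sys F P I) D → SA F r (R-sys F P' I) D)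
        × (SA F (r + k + 1) (R-sys F P' I) D → SA F r (L-sys F P I) D))
      × ((SA₊ F (r + k + 1) (L-sys F P I) D → SA₊ F r (R-sys F P' I) D)
        × (SA₊ F (r + k + 1) (R-sys F P' I) D → SA₊ F r (L-sys F P I) D))
      × ((StaticLS₊ F (r + k + 1) (L-sys F P I) D → StaticLS₊ F r (R-sys F P' I) D)
        × (StaticLS₊ F (r + k + 1) (R-sys F P' I) D → StaticLS₊ F r (L-sys F P I) D))
lemma2p3 F r _ P P' P'-ext I D =
    (SA-R-from-L , SA-L-from-R)
  , (SA₊-transfer F SA-R-from-L , SA₊-transfer F SA-L-from-R)
  , (StaticLS₊-transfer F r≤r+k+1 SA-R-from-L , StaticLS₊-transfer F r≤r+k+1 SA-L-from-R)
  where
  open Transfer.AtLevel F P P' P'-ext I D r
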